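{- Let $G=([n],E)$ be a graph and let $i,j\geq 1$. Then \[\sum_{\mathcal S\in\mathrm{ST}^{(i)}(G+P_j)}\mathrm{sign}(\mathcal S)\, e_{\mathrm{type}'(\mathcal S)}=\sum_{\mathcal F\in\mathrm{FT}^{(i)}(G+P_j)}\mathrm{sign}(\mathcal F)\, e_{\mathrm{type}'(\mathcal F)}.\]
   Context: Graphs have vertex set $[n]=\{1,\ldots,n\}$. For graphs $G=([n],E)$ and $H=([n'],E')$, the sum $G+H$ is the graph on $[n+n'-1]$ with edges $E\cup\{\{a+n-1,b+n-1\}:\{a,b\}\in E'\}$ (vertex $n$ of $G$ glued to vertex $1$ of $H$); $P_j$ is the path on $j$ vertices, so in $G+P_j$ the path occupies vertices $n,n+1,\ldots,n+j-1$. The elementary symmetric functions are $e_k=\sum_{i_1<\cdots<i_k}x_{i_1}\cdots x_{i_k}$ and $e_\lambda=e_{\lambda_1}\cdots e_{\lambda_\ell}$. Fix a total ordering on the edges of the graph. A no broken circuit (NBC) tree is a subtree whose edge set contains no set of the form $C\setminus\{\max(C)\}$ with $C$ the edge set of a cycle. A tree triple is $(T,\alpha,r)$ with $T$ an NBC tree, $\alpha$ a composition of size $|T|$ (number of vertices), and $1\leq r\leq\alpha_1$. A forest triple $\mathcal F$ is a sequence of tree triples $(T_1,\alpha^{(1)},r_1),\ldots,(T_m,\alpha^{(m)},r_m)$ whose trees partition the vertex set, with $\min(T_1)<\cdots<\min(T_m)$; its type is $\mathrm{sort}(\alpha^{(1)}\cdots\alpha^{(m)})$ (concatenate and sort into a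 partition), its sign is $(-1)^{\sum_i(\ell(\alpha^{(i)})-1)}$, and its reduced type $\mathrm{type}'(\mathcal F)$ is the type with one instance of $\alpha^{(1)}_1$ removed. A connected subgraph triple is $(H,\alpha,r)$ with $H$ a connected subgraph (not necessarily a tree), $\alpha$ a composition of size $|H|$ (number of vertices), and $1\leq r\leq\alpha_1$. A subgraph triple $\mathcal S$ is a sequence of connected subgraph triples $(H_1,\alpha^{(1)},r_1),\ldots,(H_m,\alpha^{(m)},r_m)$ whose vertex sets partition the vertex set, with $\min(H_1)<\cdots<\min(H_m)$; type and reduced type are defined as for forest triples, and $\mathrm{sign}(\mathcal S)=(-1)^{\sum_i(\ell(\alpha^{(i)})-1+|H_i|-|E(H_i)|)}$. $\mathrm{FT}^{(i)}(G+P_j)$ (resp. $\mathrm{ST}^{(i)}(G+P_j)$) is the set of forest triples (resp. subgraph triples) of $G+P_j$ such that, writing $(T,\alpha,r)$ for the triple whose tree/subgraph contains vertex $1$ and $(T',\alpha',r')$ for the one containing vertex $n$ (possibly the same triple), we have $\alpha_1=i$, $r=1$, $\{n,n+1,\ldots,n+j-1\}\subseteq T'$, and the last part of $\alpha'$ is at least $j$. -}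

module Defs where

open import Data.Nat using (ℕ; zero; suc; _+_; _∸_; _≤_; _<_; _≤ᵇ_; _≡ᵇ_)
open import Data.Nat.Properties using () renaming (_≟_ to _≟ℕ_)
open import Data.Integer as ℤ using (ℤ; +_; -_)
open import Data.Bool using (Bool; true; false; if_then_else_) renaming (_≟_ to _≟B_)
open import Data.Product using (Σ; ∃; _×_; _,_; proj₁; proj₂)
open import Data.Sum using (_⊎_)
open import Data.Nat.ListAction using (sum)
open import Data.List as L using (List; []; _∷_; length; map; filter; concatMap; zip; drop; take; _++_)
open import Data.List.Properties using (≡-dec)
open import Data.List.Membership.Propositional using (_∈_)
open import Data.List.Relation.Unary.All using (All)
open import Data.List.Relation.Unary.Unique.Propositional using (Unique)
open import Data.List.Relation.Unary.Linked using (Linked)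
open import Data.Vec using (Vec; []; _∷_)
open import Data.Fin using (Fin; toℕ)
open import Data.Fin.Subset using (Subset; ∣_∣) renaming (_∈_ to _∈ₛ_)
open import Relation.Binary.PropositionalEquality using (_≡_; _≢_)
open import Relation.Nullary using (¬_; does)

-- Vertices are labelled by natural numbers 1..N as in the paper.
-- Edges {a,b} are stored canonically as pairs (a , b) with a < b.

Edge : Set
Edge = ℕ × ℕ

IsGraph : ℕ → List Edge → Set
IsGraph n E = All (λ e → 1 ≤ proj₁ e × proj₁ e < proj₂ e × proj₂ e ≤ n) E × Unique E

-- Edges of the path P_j shifted to occupy vertices n, n+1, ..., n+j-1 :
-- {n+k-1, n+k} for k = 1 .. j-1.
pathEdgesFrom : ℕ → ℕ → List Edge
pathEdgesFrom v zero = []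
pathEdgesFrom v (suc zero) = []
pathEdgesFrom v (suc (suc k)) = (v , suc v) ∷ pathEdgesFrom (suc v) (suc k)

plusPathEdges : ℕ → ℕ → List Edge → List Edge
plusPathEdges n j E = E ++ pathEdgesFrom n j

plusPathSize : ℕ → ℕ → ℕ
plusPathSize n j = n + j ∸ 1

-- Membership of the paper vertex v ∈ ℕ (1-based) in a vertex subset.

memB : ∀ {k} → Vec Bool k → ℕ → Bool
memB [] v = false
memB (b ∷ bs) zero = false
memB (b ∷ bs) (suc zero) = b
memB (b ∷ bs) (suc (suc v)) = memB bs (suc v)

_∈ᵥ_ : ∀ {k} → ℕ → Subset k → Set
v ∈ᵥ V = memB V v ≡ true

minB : ∀ {k} → Vec Bool k → ℕ
minB [] = 0
minB (true ∷ bs) = 1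
minB (false ∷ bs) = suc (minB bs)

-- The ambient graph is given by an ordered edge list `ord` (the list order
-- is the fixed total ordering on the edges); edges of subgraphs are subsets
-- of positions in `ord`.

module _ (ord : List Edge) where

  m : ℕ
  m = length ord

  edgeAt : Fin m → Edge
  edgeAt = L.lookup ord

  Joins : Edge → ℕ → ℕ → Set
  Joins e u w = (e ≡ (u , w)) ⊎ (e ≡ (w , u))

  cyclePairs : List ℕ → List (ℕ × ℕ)
  cyclePairs vs = zip vs (drop 1 vs ++ take 1 vs)

  IsCycleEdgeSet : Subset m → Set
  IsCycleEdgeSet C =
    Σ (List ℕ) λ vs →
      3 ≤ length vs × Unique vs ×
      (∀ {uw} → uw ∈ cyclePairs vs → ∃ λ p → Joins (edgeAt p) (proj₁ uw) (proj₂ uw)) ×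
      (∀ p → p ∈ₛ C → Σ (ℕ × ℕ) λ uw → uw ∈ cyclePairs vs × Joins (edgeAt p) (proj₁ uw) (proj₂ uw)) ×
      (∀ p uw → uw ∈ cyclePairs vs → Joins (edgeAt p) (proj₁ uw) (proj₂ uw) → p ∈ₛ C)

  BrokenCircuitIn : Subset m → Subset m → Set
  BrokenCircuitIn C F =
    Σ (Fin m) λ q → q ∈ₛ C × (∀ p → p ∈ₛ C → toℕ p ≤ toℕ q) ×
      (∀ p → p ∈ₛ C → p ≢ q → p ∈ₛ F)

  module _ {N : ℕ} where

    data Reach (F : Subset m) : ℕ → ℕ → Set where
      here : ∀ {u} → Reach F u u
      step : ∀ {u w v} (p : Fin m) → p ∈ₛ F → Joins (edgeAt p) u w → Reach F w v → Reach F u v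

    IsSubgraph : Subset N → Subset m → Set
    IsSubgraph V F = ∀ p → p ∈ₛ F → proj₁ (edgeAt p) ∈ᵥ V × proj₂ (edgeAt p) ∈ᵥ V

    IsConnectedSubgraph : Subset N → Subset m → Set
    IsConnectedSubgraph V F =
      IsSubgraph V F × (∀ u v → u ∈ᵥ V → v ∈ᵥ V → Reach F u v)

    IsTree : Subset N → Subset m → Set
    IsTree V F = IsConnectedSubgraph V F × (∀ C → IsCycleEdgeSet C → ¬ (∀ p → p ∈ₛ C → p ∈ₛ F))

    IsNBCTree : Subset N → Subset m → Set
    IsNBCTree V F = IsTree V F × (∀ C → IsCycleEdgeSet C → ¬ BrokenCircuitIn C F)

-- Triples (H, α, r); H given by its vertex set and edge set.

record Triple (N m : ℕ) : Set where
  constructor triple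
  field
    verts : Subset N
    edges : Subset m
    comp  : List ℕ
    rr    : ℕ
open Triple public

headOr0 : List ℕ → ℕ
headOr0 [] = 0
headOr0 (x ∷ _) = x

lastOr0 : List ℕ → ℕ
lastOr0 [] = 0
lastOr0 (x ∷ []) = x
lastOr0 (x ∷ y ∷ xs) = lastOr0 (y ∷ xs)

IsComposition : List ℕ → ℕ → Set
IsComposition α k = All (1 ≤_) α × sum α ≡ k

GoodLabels : ∀ {N m} → Triple N m → Set
GoodLabels t = IsComposition (comp t) ∣ verts t ∣ × 1 ≤ rr t × rr t ≤ headOr0 (comp t)

IsOrderedPartition : ∀ {N m} → List (Triple N m) → Set
IsOrderedPartition {N} S =
  (∀ v → 1 ≤ v → v ≤ N → length (filter (λ t → memB (verts t) v ≟B true) S) ≡ 1) ×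
  Linked _<_ (map (λ t → minB (verts t)) S)

module _ (ord : List Edge) {N : ℕ} where

  IsSubgraphTriple : List (Triple N (m ord)) → Set
  IsSubgraphTriple S =
    All (λ t → IsConnectedSubgraph ord {N} (verts t) (edges t) × GoodLabels t) S ×
    IsOrderedPartition S

  IsForestTriple : List (Triple N (m ord)) → Set
  IsForestTriple S =
    All (λ t → IsNBCTree ord {N} (verts t) (edges t) × GoodLabels t) S ×
    IsOrderedPartition S

-- the extra conditions defining FT^{(i)}(G+P_j) / ST^{(i)}(G+P_j)
SuperscriptCond : ∀ {N m} → ℕ → ℕ → ℕ → List (Triple N m) → Set
SuperscriptCond n j i S =
  (∀ t → t ∈ S → 1 ∈ᵥ verts t → headOr0 (comp t) ≡ i × rr t ≡ 1) ×
  (∀ t → t ∈ S → n ∈ᵥ verts t →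
     (∀ v → n ≤ v → v ≤ n + j ∸ 1 → v ∈ᵥ verts t) × j ≤ lastOr0 (comp t))

insertDesc : ℕ → List ℕ → List ℕ
insertDesc x [] = x ∷ []
insertDesc x (y ∷ ys) = if y ≤ᵇ x then x ∷ y ∷ ys else y ∷ insertDesc x ys

sortDesc : List ℕ → List ℕ
sortDesc = L.foldr insertDesc []

removeOne : ℕ → List ℕ → List ℕ
removeOne x [] = []
removeOne x (y ∷ ys) = if x ≡ᵇ y then ys else y ∷ removeOne x ys

type : ∀ {N m} → List (Triple N m) → List ℕ
type S = sortDesc (concatMap comp S)

type′ : ∀ {N m} → List (Triple N m) → List ℕ
type′ [] = type {0} {0} []
type′ S@(t ∷ _) = removeOne (headOr0 (comp t)) (type S)

negOnePow : ℕ → ℤ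
negOnePow zero = + 1
negOnePow (suc k) = - negOnePow k

signF : ∀ {N m} → List (Triple N m) → ℤ
signF S = negOnePow (sum (map (λ t → length (comp t) ∸ 1) S))

signS : ∀ {N m} → List (Triple N m) → ℤ
signS S = negOnePow ℤ.∣ L.foldr ℤ._+_ (+ 0)
  (map (λ t → (+ (length (comp t) ∸ 1)) ℤ.+ ((+ ∣ edges t ∣) ℤ.- (+ ∣ verts t ∣) ℤ.+ + 1)) S) ∣

-- coefficient of e_λ in Σ_{S ∈ L} sign(S) e_{type′(S)}
coeffE : ∀ {N m} → (List (Triple N m) → ℤ) → List (List (Triple N m)) → List ℕ → ℤ
coeffE sg L λ′ = L.foldr ℤ._+_ (+ 0)
  (map (λ S → if does (≡-dec _≟ℕ_ (type′ S) λ′) then sg S else + 0) L)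

{-# OPTIONS --safe #-}
module Submission where

-- The signs of subgraph triples cancel in pairs, leaving exactly the forest triples.
-- Call an edge q bad for a subgraph H if its ends are joined in H by a walk through
-- edges smaller than q. Toggling the least bad edge of the first component that has
-- one keeps that component connected and does not change which edges below q are bad,
-- so it is an involution. It changes |E(H)| by one, hence flips the sign, and leaves
-- vertex sets, compositions and r untouched, hence the reduced type and the conditions
-- defining ST⁽ⁱ⁾ and FT⁽ⁱ⁾. Its fixed points are the families of connected subgraphs
-- without bad edges, which are exactly the families of NBC trees; since a tree has
-- |H| − |E(H)| = 1, the two signs agree there.

open import Defs
open import Data.Bool as Bool using (true; false; not; if_then_else_)
open import Data.Bool.Properties using (not-involutive)
open import Data.Empty using (⊥; ⊥-elim)
open import Data.Fin as Fin using (Fin; zero; suc; toℕ)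
import Data.Fin.Properties as Fin
open import Data.Fin.Subset as Subset using (Subset; ∣_∣; _-_; Nonempty; inside; outside)
  renaming (_∈_ to _∈ₛ_; _∉_ to _∉ₛ_)
open import Data.Fin.Subset.Properties as Subset using (nonempty?; x∈p⇒∣p-x∣<∣p∣; x∈p∧x≢y⇒x∈p-y; p─q⊆p)
open import Data.Integer as ℤ using (ℤ; +_; -_; -[1+_])
import Data.Integer.Properties as ℤ
open import Algebra.Properties.CommutativeSemigroup ℤ.+-commutativeSemigroup using (x∙yz≈y∙xz; xy∙z≈xz∙y)
open import Data.Integer.Tactic.RingSolver using (solve-∀)
open import Data.List as List using (List; []; _∷_; length; map; filter; foldr; concat; _++_; _∷ʳ_; zip)
import Data.List.Properties as List
open import Data.List.Membership.Propositional using (_∈_; find; lose)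
open import Data.List.Membership.Propositional.Properties
  using (∈-map⁺; ∈-map⁻; ∈-filter⁺; ∈-filter⁻; ∈-∃++; ∈-++⁺ˡ; ∈-++⁺ʳ; ∈-++⁻; ∈-lookup)
open import Data.List.Membership.Propositional.Properties.WithK using (unique∧set⇒bag)
open import Data.List.Relation.Unary.All as All using (All; []; _∷_)
import Data.List.Relation.Unary.All.Properties as All
open import Data.List.Relation.Unary.Any as Any using (Any; here; there)
open import Data.List.Relation.Unary.Linked using (Linked)
open import Data.List.Relation.Unary.Unique.Propositional using (Unique; []; _∷_)
import Data.List.Relation.Unary.Unique.Propositional.Properties as Unique
open import Data.List.Relation.Binary.BagAndSetEquality using (∼bag⇒↭)
open import Data.List.Relation.Binary.Permutation.Propositional as ↭ using (_↭_; ↭-sym; ↭-trans; ↭-refl; ↭⇒↭ₛ)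
open import Data.List.Relation.Binary.Permutation.Propositional.Properties using (∈-resp-↭; ∷↭∷ʳ; ↭-length; All-resp-↭)
import Data.List.Relation.Binary.Permutation.Setoid.Properties as ↭ₛ
open import Data.Maybe as Maybe using (Maybe; just; nothing)
open import Data.Nat as ℕ using (ℕ; zero; suc; _+_; _∸_; _≤_; _<_; z≤n; s≤s)
import Data.Nat.Properties as ℕ
open import Data.List.Membership.DecPropositional ℕ._≟_ using (_∈?_)
open import Data.Nat.ListAction using (sum)
open import Data.Product using (Σ; ∃; ∃₂; _×_; _,_; proj₁; proj₂; uncurry)
open import Data.Product.Properties using () renaming (≡-dec to ×-≡-dec)
open import Data.Sum as Sum using (_⊎_; inj₁; inj₂; [_,_])
open import Data.Vec as Vec using ([]; _∷_; lookup; tabulate)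
open import Data.Vec.Properties using ([]=⇒lookup; lookup⇒[]=; lookup∘tabulate)
open import Function using (_∘_; id; _⇔_; mk⇔; Equivalence; case_of_)
open import Relation.Binary.PropositionalEquality as ≡ using (_≡_; _≢_; refl; sym; trans; cong; cong₂; subst)
open import Relation.Nullary using (¬_; Dec; yes; no; does; contradiction)
open import Relation.Nullary.Decidable using (map′; _⊎-dec_; _×-dec_; ¬?; dec-true)
open import Relation.Unary using (Decidable)

-- Signed sums

self-negating⇒0 : ∀ {i} → i ≡ - i → i ≡ + 0
self-negating⇒0 {+ zero} _ = refl
self-negating⇒0 {+ suc _} ()
self-negating⇒0 { -[1+ _ ]} ()

module _ {A : Set} where

  ∑ : (A → ℤ) → List A → ℤ
  ∑ f xs = foldr ℤ._+_ (+ 0) (map f xs)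

  ∑-↭ : ∀ (f : A → ℤ) {xs ys} → xs ↭ ys → ∑ f xs ≡ ∑ f ys
  ∑-↭ f ↭.refl = refl
  ∑-↭ f (↭.prep x p) = cong (λ s → f x ℤ.+ s) (∑-↭ f p)
  ∑-↭ f (↭.swap x y p) = trans (cong (λ s → f x ℤ.+ (f y ℤ.+ s)) (∑-↭ f p)) (x∙yz≈y∙xz (f x) (f y) _)
  ∑-↭ f (↭.trans p q) = trans (∑-↭ f p) (∑-↭ f q)

  ∑-cong : ∀ {f g : A → ℤ} {xs} → (∀ {x} → x ∈ xs → f x ≡ g x) → ∑ f xs ≡ ∑ g xs
  ∑-cong f≗g = cong (foldr ℤ._+_ (+ 0)) (List.map-cong-local (All.tabulate f≗g))

  ∑-neg : ∀ (f : A → ℤ) xs → ∑ (-_ ∘ f) xs ≡ - ∑ f xs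
  ∑-neg f [] = refl
  ∑-neg f (x ∷ xs) = trans (cong (λ s → - f x ℤ.+ s) (∑-neg f xs)) (sym (ℤ.neg-distrib-+ (f x) (∑ f xs)))

  ∑-unique-⇔ : ∀ (f : A → ℤ) {xs ys} → Unique xs → Unique ys →
               (∀ {x} → x ∈ xs ⇔ x ∈ ys) → ∑ f xs ≡ ∑ f ys
  ∑-unique-⇔ f uxs uys xs≈ys = ∑-↭ f (∼bag⇒↭ (unique∧set⇒bag uxs uys xs≈ys))

  ∑-filter : ∀ (f : A → ℤ) {P : A → Set} (P? : Decidable P) xs →
             ∑ f xs ≡ ∑ f (filter P? xs) ℤ.+ ∑ f (filter (¬? ∘ P?) xs)
  ∑-filter f P? [] = refl
  ∑-filter f P? (x ∷ xs) with P? x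
  ... | yes _ = trans (cong (λ s → f x ℤ.+ s) (∑-filter f P? xs)) (sym (ℤ.+-assoc (f x) (∑ f (filter P? xs)) _))
  ... | no _ = trans (cong (λ s → f x ℤ.+ s) (∑-filter f P? xs)) (x∙yz≈y∙xz (f x) (∑ f (filter P? xs)) _)

  ∑-sign-reversing-involution :
    ∀ (w : A → ℤ) (ι : A → A) {Fixed : A → Set} (Fixed? : Decidable Fixed) →
    (∀ x → ι (ι x) ≡ x) → (∀ {x} → ¬ Fixed x → ¬ Fixed (ι x)) →
    (∀ {x} → ¬ Fixed x → w (ι x) ≡ - w x) →
    ∀ {xs} → Unique xs → (∀ {x} → x ∈ xs → ι x ∈ xs) →
    ∑ w xs ≡ ∑ w (filter Fixed? xs)
  ∑-sign-reversing-involution w ι Fixed? ιι moved moved-sign {xs} uxs closed = begin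
    ∑ w xs                            ≡⟨ ∑-filter w Fixed? xs ⟩
    ∑ w (filter Fixed? xs) ℤ.+ ∑ w ys ≡⟨ cong (λ s → ∑ w (filter Fixed? xs) ℤ.+ s) cancel ⟩
    ∑ w (filter Fixed? xs) ℤ.+ + 0    ≡⟨ ℤ.+-identityʳ _ ⟩
    ∑ w (filter Fixed? xs)            ∎
    where
    open ≡.≡-Reasoning
    ys = filter (¬? ∘ Fixed?) xs
    uys : Unique ys
    uys = Unique.filter⁺ (¬? ∘ Fixed?) uxs
    ι-injective : ∀ {x y} → ι x ≡ ι y → x ≡ y
    ι-injective {x} {y} e = trans (sym (ιι x)) (trans (cong ι e) (ιι y))
    ys≈ιys : ∀ {x} → x ∈ ys ⇔ x ∈ map ι ys
    ys≈ιys {x} = mk⇔ to from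
      where
      to : x ∈ ys → x ∈ map ι ys
      to x∈ = let (x∈xs , ¬fx) = ∈-filter⁻ (¬? ∘ Fixed?) x∈ in
        subst (_∈ map ι ys) (ιι x) (∈-map⁺ ι (∈-filter⁺ (¬? ∘ Fixed?) (closed x∈xs) (moved ¬fx)))
      from : x ∈ map ι ys → x ∈ ys
      from ιy∈ with ∈-map⁻ ι ιy∈
      ... | y , y∈ , refl = let (y∈xs , ¬fy) = ∈-filter⁻ (¬? ∘ Fixed?) y∈ in
        ∈-filter⁺ (¬? ∘ Fixed?) (closed y∈xs) (moved ¬fy)
    s≡-s : ∑ w ys ≡ - ∑ w ys
    s≡-s = begin
      ∑ w ys           ≡⟨ ∑-unique-⇔ w uys (Unique.map⁺ ι-injective uys) ys≈ιys ⟩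
      ∑ w (map ι ys)   ≡⟨ cong (foldr ℤ._+_ (+ 0)) (sym (List.map-∘ ys)) ⟩
      ∑ (w ∘ ι) ys     ≡⟨ ∑-cong {xs = ys} (λ y∈ → moved-sign (proj₂ (∈-filter⁻ (¬? ∘ Fixed?) {xs = xs} y∈))) ⟩
      ∑ (-_ ∘ w) ys    ≡⟨ ∑-neg w ys ⟩
      - ∑ w ys         ∎
    cancel : ∑ w ys ≡ + 0
    cancel = self-negating⇒0 s≡-s

negOnePow-suc : ∀ x → negOnePow ℤ.∣ x ℤ.+ + 1 ∣ ≡ - negOnePow ℤ.∣ x ∣
negOnePow-suc (+ k) rewrite ℕ.+-comm k 1 = refl
negOnePow-suc -[1+ zero ] = refl
negOnePow-suc -[1+ suc k ] = sym (ℤ.neg-involutive _)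

OffByOne : ℤ → ℤ → Set
OffByOne x y = y ≡ x ℤ.+ + 1 ⊎ x ≡ y ℤ.+ + 1

negOnePow-offByOne : ∀ {x y} → OffByOne x y → negOnePow ℤ.∣ y ∣ ≡ - negOnePow ℤ.∣ x ∣
negOnePow-offByOne {x} (inj₁ refl) = negOnePow-suc x
negOnePow-offByOne {y = y} (inj₂ refl) = trans (sym (ℤ.neg-involutive _)) (cong -_ (sym (negOnePow-suc y)))

offByOne-+ʳ : ∀ {x y} s → OffByOne x y → OffByOne (x ℤ.+ s) (y ℤ.+ s)
offByOne-+ʳ {x} s (inj₁ refl) = inj₁ (xy∙z≈xz∙y x (+ 1) s)
offByOne-+ʳ {y = y} s (inj₂ refl) = inj₂ (xy∙z≈xz∙y y (+ 1) s)

offByOne-+ˡ : ∀ {x y} a → OffByOne x y → OffByOne (a ℤ.+ x) (a ℤ.+ y)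
offByOne-+ˡ {x} a (inj₁ refl) = inj₁ (sym (ℤ.+-assoc a x (+ 1)))
offByOne-+ˡ {y = y} a (inj₂ refl) = inj₂ (sym (ℤ.+-assoc a y (+ 1)))

first : ∀ {k} {P : Fin k → Set} → Decidable P → Maybe (Fin k)
first {zero} P? = nothing
first {suc k} P? = if does (P? zero) then just zero else Maybe.map suc (first (P? ∘ suc))

first-just : ∀ {k} {P : Fin k → Set} (P? : Decidable P) {q} → first P? ≡ just q →
             P q × (∀ p → p Fin.< q → ¬ P p)
first-just {suc k} P? e with P? zero
first-just {suc k} P? refl | yes P0 = P0 , λ _ ()
first-just {suc k} P? e | no ¬P0 with first (P? ∘ suc) in e′
first-just {suc k} P? refl | no ¬P0 | just q with first-just (P? ∘ suc) e′
... | Pq , least = Pq , λ { zero _ → ¬P0 ; (suc p) (s≤s p<q) → least p p<q }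

first-nothing : ∀ {k} {P : Fin k → Set} (P? : Decidable P) → first P? ≡ nothing → ∀ p → ¬ P p
first-nothing {suc k} P? e p with P? zero
first-nothing {suc k} P? () p | yes _
first-nothing {suc k} P? e p | no ¬P0 with first (P? ∘ suc) in e′
first-nothing {suc k} P? refl zero | no ¬P0 | nothing = ¬P0
first-nothing {suc k} P? refl (suc p) | no ¬P0 | nothing = first-nothing (P? ∘ suc) e′ p

first-least : ∀ {k} {P : Fin k → Set} (P? : Decidable P) {q} → P q → (∀ p → p Fin.< q → ¬ P p) →
              first P? ≡ just q
first-least {suc k} P? {zero} Pq least with P? zero
... | yes _ = refl
... | no ¬P0 = ⊥-elim (¬P0 Pq)
first-least {suc k} P? {suc q} Pq least with P? zero
... | yes P0 = ⊥-elim (least zero (s≤s z≤n) P0)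
... | no _ = cong (Maybe.map suc) (first-least (P? ∘ suc) Pq (λ p p<q → least (suc p) (s≤s p<q)))

Unique-↭ : ∀ {A : Set} {xs ys : List A} → xs ↭ ys → Unique xs → Unique ys
Unique-↭ p = ↭ₛ.Unique-resp-↭ (≡.setoid _) (↭⇒↭ₛ p)

lookup-injective : ∀ {A : Set} {xs : List A} → Unique xs → ∀ {p q} → List.lookup xs p ≡ List.lookup xs q → p ≡ q
lookup-injective {xs = x ∷ xs} u {zero} {zero} e = refl
lookup-injective {xs = x ∷ xs} u {zero} {suc q} e =
  contradiction (subst (_∈ xs) (sym e) (∈-lookup q)) (Unique.Unique[x∷xs]⇒x∉xs u)
lookup-injective {xs = x ∷ xs} u {suc p} {zero} e =
  contradiction (subst (_∈ xs) e (∈-lookup p)) (Unique.Unique[x∷xs]⇒x∉xs u)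
lookup-injective {xs = x ∷ xs} (_ ∷ u) {suc p} {suc q} e = cong suc (lookup-injective u e)

length-filter-map : ∀ {A B : Set} {P : B → Set} (P? : Decidable P) (f : A → B) xs →
                    length (filter (P? ∘ f) xs) ≡ length (filter P? (map f xs))
length-filter-map P? f [] = refl
length-filter-map P? f (x ∷ xs) with does (P? (f x))
... | true = cong suc (length-filter-map P? f xs)
... | false = length-filter-map P? f xs

rotate : ∀ {A : Set} → List A → List A
rotate [] = []
rotate (x ∷ xs) = xs ∷ʳ x

rotate^ : ∀ {A : Set} → ℕ → List A → List A
rotate^ zero xs = xs
rotate^ (suc k) xs = rotate^ k (rotate xs)

rotate^-rotate : ∀ {A : Set} k (xs : List A) → rotate^ k (rotate xs) ≡ rotate (rotate^ k xs)
rotate^-rotate zero xs = refl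
rotate^-rotate (suc k) xs = rotate^-rotate k (rotate xs)

rotate^-↭ : ∀ {A : Set} k (xs : List A) → rotate^ k xs ↭ xs
rotate^-↭ zero xs = ↭-refl
rotate^-↭ (suc k) [] = rotate^-↭ k []
rotate^-↭ (suc k) (x ∷ xs) = ↭-trans (rotate^-↭ k (xs ∷ʳ x)) (↭-sym (∷↭∷ʳ x xs))

rotate^-++ : ∀ {A : Set} (xs ys : List A) → rotate^ (length xs) (xs ++ ys) ≡ ys ++ xs
rotate^-++ [] ys = sym (List.++-identityʳ ys)
rotate^-++ (x ∷ xs) ys = begin
  rotate^ (length xs) ((xs ++ ys) ∷ʳ x)   ≡⟨ cong (rotate^ (length xs)) (List.++-assoc xs ys (x ∷ [])) ⟩
  rotate^ (length xs) (xs ++ ys ∷ʳ x)     ≡⟨ rotate^-++ xs (ys ∷ʳ x) ⟩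
  (ys ∷ʳ x) ++ xs                         ≡⟨ List.++-assoc ys (x ∷ []) xs ⟩
  ys ++ x ∷ xs                            ∎
  where open ≡.≡-Reasoning

rotate-to-end : ∀ {A : Set} {x : A} {xs} → x ∈ xs → ∃₂ λ k ys → rotate^ k xs ≡ ys ∷ʳ x
rotate-to-end x∈xs with ∈-∃++ x∈xs
... | ys , zs , refl = suc (length ys) , zs ++ ys ,
  trans (rotate^-rotate (length ys) (ys ++ _ ∷ zs)) (cong rotate (rotate^-++ ys (_ ∷ zs)))

pathPairs : ℕ → List ℕ → List (ℕ × ℕ)
pathPairs a [] = []
pathPairs a (b ∷ l) = (a , b) ∷ pathPairs b l

lastOf : ℕ → List ℕ → ℕ
lastOf a [] = a
lastOf a (b ∷ l) = lastOf b l

pathPairs-∷ʳ : ∀ a l z → pathPairs a (l ∷ʳ z) ≡ pathPairs a l ∷ʳ (lastOf a l , z)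
pathPairs-∷ʳ a [] z = refl
pathPairs-∷ʳ a (b ∷ l) z = cong ((a , b) ∷_) (pathPairs-∷ʳ b l z)

lastOf-∷ʳ : ∀ a l z → lastOf a (l ∷ʳ z) ≡ z
lastOf-∷ʳ a [] z = refl
lastOf-∷ʳ a (b ∷ l) z = lastOf-∷ʳ b l z

zip-∷ʳ≡pathPairs : ∀ a l z → zip (a ∷ l) (l ∷ʳ z) ≡ pathPairs a l ∷ʳ (lastOf a l , z)
zip-∷ʳ≡pathPairs a [] z = refl
zip-∷ʳ≡pathPairs a (b ∷ l) z = cong ((a , b) ∷_) (zip-∷ʳ≡pathPairs b l z)

lastOf-∈ : ∀ a b l → lastOf a (b ∷ l) ∈ b ∷ l
lastOf-∈ a b [] = here refl
lastOf-∈ a b (c ∷ l) = there (lastOf-∈ b c l)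

pathPairs-proj₁ : ∀ {π} a l → π ∈ pathPairs a l → proj₁ π ∈ a ∷ l
pathPairs-proj₁ a (b ∷ l) (here refl) = here refl
pathPairs-proj₁ a (b ∷ l) (there π∈) = there (pathPairs-proj₁ b l π∈)

pathPairs-proj₂ : ∀ {π} a l → π ∈ pathPairs a l → proj₂ π ∈ l
pathPairs-proj₂ a (b ∷ l) (here refl) = here refl
pathPairs-proj₂ a (b ∷ l) (there π∈) = there (pathPairs-proj₂ b l π∈)

pathPairs-avoid-ends : ∀ h t {π} → Unique (h ∷ t) → 2 ≤ length t → π ∈ pathPairs h t →
                       π ≢ (lastOf h t , h) × π ≢ (h , lastOf h t)
pathPairs-avoid-ends h (b ∷ []) _ (s≤s ()) _
pathPairs-avoid-ends h (b ∷ c ∷ t) {π} u@(_ ∷ u′) _ π∈ = ends≢ , starts≢ π∈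
  where
  h∉ = Unique.Unique[x∷xs]⇒x∉xs u
  b∉ = Unique.Unique[x∷xs]⇒x∉xs u′
  ends≢ : π ≢ (lastOf h (b ∷ c ∷ t) , h)
  ends≢ refl = h∉ (pathPairs-proj₂ h (b ∷ c ∷ t) π∈)
  starts≢ : π ∈ pathPairs h (b ∷ c ∷ t) → π ≢ (h , lastOf h (b ∷ c ∷ t))
  starts≢ (here refl) e = b∉ (subst (_∈ c ∷ t) (sym (cong proj₂ e)) (lastOf-∈ b c t))
  starts≢ (there π∈′) e = h∉ (subst (_∈ b ∷ c ∷ t) (cong proj₁ e) (pathPairs-proj₁ b (c ∷ t) π∈′))

select : ∀ {k} {P : Fin k → Set} → Decidable P → Subset k
select P? = tabulate (does ∘ P?)

module _ {k} {P : Fin k → Set} (P? : Decidable P) where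

  ∈-select⁺ : ∀ {p} → P p → p ∈ₛ select P?
  ∈-select⁺ {p} Pp = lookup⇒[]= p (select P?) (trans (lookup∘tabulate (does ∘ P?) p) (dec-true (P? p) Pp))

  ∈-select⁻ : ∀ {p} → p ∈ₛ select P? → P p
  ∈-select⁻ {p} p∈ with P? p | trans (sym (lookup∘tabulate (does ∘ P?) p)) ([]=⇒lookup p∈)
  ... | yes Pp | _ = Pp
  ... | no _ | ()

toggle : ∀ {k} → Fin k → Subset k → Subset k
toggle zero (b ∷ F) = not b ∷ F
toggle (suc q) (b ∷ F) = b ∷ toggle q F

toggle-toggle : ∀ {k} (q : Fin k) F → toggle q (toggle q F) ≡ F
toggle-toggle zero (b ∷ F) = cong (_∷ F) (not-involutive b)
toggle-toggle (suc q) (b ∷ F) = cong (b ∷_) (toggle-toggle q F)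

lookup-toggle-≢ : ∀ {k} {p q : Fin k} F → p ≢ q → lookup (toggle q F) p ≡ lookup F p
lookup-toggle-≢ {p = zero} {zero} F p≢q = contradiction refl p≢q
lookup-toggle-≢ {p = zero} {suc q} (b ∷ F) p≢q = refl
lookup-toggle-≢ {p = suc p} {zero} (b ∷ F) p≢q = refl
lookup-toggle-≢ {p = suc p} {suc q} (b ∷ F) p≢q = lookup-toggle-≢ F (p≢q ∘ cong suc)

∈-toggle-≢ : ∀ {k} {p q : Fin k} {F} → p ≢ q → p ∈ₛ toggle q F ⇔ p ∈ₛ F
∈-toggle-≢ {p = p} {q} {F} p≢q = mk⇔
  (λ p∈ → lookup⇒[]= p F (trans (sym (lookup-toggle-≢ F p≢q)) ([]=⇒lookup p∈)))
  (λ p∈ → lookup⇒[]= p (toggle q F) (trans (lookup-toggle-≢ F p≢q) ([]=⇒lookup p∈)))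

∣toggle∣-∈ : ∀ {k} {q : Fin k} {F} → q ∈ₛ F → suc ∣ toggle q F ∣ ≡ ∣ F ∣
∣toggle∣-∈ {q = zero} Vec.here = refl
∣toggle∣-∈ {q = suc q} {inside ∷ F} (Vec.there q∈) = cong suc (∣toggle∣-∈ q∈)
∣toggle∣-∈ {q = suc q} {outside ∷ F} (Vec.there q∈) = ∣toggle∣-∈ q∈

∣toggle∣-∉ : ∀ {k} {q : Fin k} {F} → q ∉ₛ F → ∣ toggle q F ∣ ≡ suc ∣ F ∣
∣toggle∣-∉ {q = zero} {inside ∷ F} q∉ = contradiction Vec.here q∉
∣toggle∣-∉ {q = zero} {outside ∷ F} q∉ = refl
∣toggle∣-∉ {q = suc q} {inside ∷ F} q∉ = cong suc (∣toggle∣-∉ (q∉ ∘ Vec.there))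
∣toggle∣-∉ {q = suc q} {outside ∷ F} q∉ = ∣toggle∣-∉ (q∉ ∘ Vec.there)

x∉p-x : ∀ {k} (F : Subset k) x → x ∉ₛ F - x
x∉p-x (_ ∷ F) zero ()
x∉p-x (_ ∷ F) (suc x) (Vec.there x∈) = x∉p-x F x x∈

tail-⇔ : ∀ {k v x y} {V X Y : Subset k} → (∀ {i} → i ∈ₛ v ∷ V ⇔ (i ∈ₛ x ∷ X ⊎ i ∈ₛ y ∷ Y)) →
         ∀ {i} → i ∈ₛ V ⇔ (i ∈ₛ X ⊎ i ∈ₛ Y)
tail-⇔ V⇔ = mk⇔ (Sum.map Subset.drop-there Subset.drop-there ∘ Equivalence.to V⇔ ∘ Vec.there)
                (Subset.drop-there ∘ Equivalence.from V⇔ ∘ Sum.map Vec.there Vec.there)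

tail-disjoint : ∀ {k x y} {X Y : Subset k} → (∀ {i} → i ∈ₛ x ∷ X → i ∉ₛ y ∷ Y) → ∀ {i} → i ∈ₛ X → i ∉ₛ Y
tail-disjoint disjoint i∈X i∈Y = disjoint (Vec.there i∈X) (Vec.there i∈Y)

∣∣-partition : ∀ {k} {V X Y : Subset k} → (∀ {i} → i ∈ₛ V ⇔ (i ∈ₛ X ⊎ i ∈ₛ Y)) →
               (∀ {i} → i ∈ₛ X → i ∉ₛ Y) → ∣ V ∣ ≡ ∣ X ∣ + ∣ Y ∣
∣∣-partition {V = []} {[]} {[]} _ _ = refl
∣∣-partition {V = _ ∷ _} {true ∷ _} {true ∷ _} _ disjoint = contradiction Vec.here (disjoint Vec.here)
∣∣-partition {V = _ ∷ _} {true ∷ X} {false ∷ Y} V⇔ disjoint with Equivalence.from V⇔ (inj₁ Vec.here)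
... | Vec.here = cong suc (∣∣-partition (tail-⇔ V⇔) (tail-disjoint disjoint))
∣∣-partition {V = _ ∷ _} {false ∷ X} {true ∷ Y} V⇔ disjoint with Equivalence.from V⇔ (inj₂ Vec.here)
... | Vec.here = trans (cong suc (∣∣-partition (tail-⇔ V⇔) (tail-disjoint disjoint))) (sym (ℕ.+-suc ∣ X ∣ ∣ Y ∣))
∣∣-partition {V = true ∷ _} {false ∷ _} {false ∷ _} V⇔ _ with Equivalence.to V⇔ Vec.here
... | inj₁ ()
... | inj₂ ()
∣∣-partition {V = false ∷ _} {false ∷ _} {false ∷ _} V⇔ disjoint = ∣∣-partition (tail-⇔ V⇔) (tail-disjoint disjoint)

0<∣p∣⇒nonempty : ∀ {k} {V : Subset k} → 1 ≤ ∣ V ∣ → Nonempty V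
0<∣p∣⇒nonempty {k} {V} 0<∣V∣ with nonempty? V
... | yes nonempty = nonempty
... | no ∅ = contradiction (subst (1 ≤_) (trans (cong ∣_∣ (Subset.Empty-unique ∅)) (Subset.∣⊥∣≡0 k)) 0<∣V∣) λ ()

max-∈ : ∀ {k} {C : Subset k} {p} → p ∈ₛ C → Σ (Fin k) λ q → q ∈ₛ C × (∀ p → p ∈ₛ C → toℕ p ≤ toℕ q)
max-∈ {C = b ∷ C} p∈ with nonempty? C
... | yes (p , p∈C) = let (q , q∈ , max) = max-∈ p∈C in
  suc q , Vec.there q∈ , λ { zero _ → z≤n ; (suc p) p∈ → s≤s (max p (Subset.drop-there p∈)) }
max-∈ {C = b ∷ C} Vec.here | no ∅ = zero , Vec.here , λ { zero _ → z≤n ; (suc p) p∈ → contradiction (p , Subset.drop-there p∈) ∅ }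
max-∈ {C = b ∷ C} (Vec.there p∈) | no ∅ = contradiction (_ , p∈) ∅

vertex : ∀ {k} → Fin k → ℕ
vertex i = suc (toℕ i)

∈ᵥ⇔∈ₛ : ∀ {k} {V : Subset k} {i} → vertex i ∈ᵥ V ⇔ i ∈ₛ V
∈ᵥ⇔∈ₛ {V = V} {i} = mk⇔ (λ e → lookup⇒[]= i V (trans (sym (memB-vertex V i)) e))
                        (λ i∈ → trans (memB-vertex V i) ([]=⇒lookup i∈))
  where
  memB-vertex : ∀ {k} (V : Subset k) i → memB V (vertex i) ≡ lookup V i
  memB-vertex (b ∷ V) zero = refl
  memB-vertex (b ∷ V) (suc i) = memB-vertex V i

∈ᵥ⇒vertex : ∀ {k} {V : Subset k} {v} → v ∈ᵥ V → ∃ λ (i : Fin k) → v ≡ vertex i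
∈ᵥ⇒vertex {V = b ∷ V} {suc zero} _ = zero , refl
∈ᵥ⇒vertex {V = b ∷ V} {suc (suc v)} v∈ = let (i , v≡) = ∈ᵥ⇒vertex {V = V} v∈ in suc i , cong suc v≡

-- The data of a triple that the involution below leaves untouched: everything but the edges.
Skeleton : ℕ → Set
Skeleton N = Subset N × List ℕ × ℕ

module _ {N m : ℕ} where

  skeleton : Triple N m → Skeleton N
  skeleton t = verts t , comp t , rr t

  SameSkeletons : List (Triple N m) → List (Triple N m) → Set
  SameSkeletons S S′ = map skeleton S ≡ map skeleton S′

  Skeletal : (List (Triple N m) → Set) → Set
  Skeletal P = ∀ {S S′} → SameSkeletons S S′ → P S′ → P S

  map-skeletal : ∀ {B : Set} (f : Skeleton N → B) {S S′} → SameSkeletons S S′ →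
                 map (f ∘ skeleton) S ≡ map (f ∘ skeleton) S′
  map-skeletal f {S} {S′} same = trans (List.map-∘ S) (trans (cong (map f) same) (sym (List.map-∘ S′)))

  all-skeletal : ∀ (Q : Skeleton N → Set) → Skeletal (λ S → ∀ t → t ∈ S → Q (skeleton t))
  all-skeletal Q same all t t∈ with ∈-map⁻ skeleton (subst (skeleton t ∈_) same (∈-map⁺ skeleton t∈))
  ... | t′ , t′∈ , e = subst Q (sym e) (all t′ t′∈)

  type′-skeletal : ∀ {S S′} → SameSkeletons S S′ → type′ S ≡ type′ S′
  type′-skeletal {[]} {[]} _ = refl
  type′-skeletal {t ∷ S} {t′ ∷ S′} same =
    cong₂ removeOne (cong (headOr0 ∘ proj₁ ∘ proj₂) (proj₁ (List.∷-injective same)))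
                    (cong (sortDesc ∘ concat) (map-skeletal (λ (s : Skeleton N) → proj₁ (proj₂ s)) {t ∷ S} {t′ ∷ S′} same))

  orderedPartition-skeletal : Skeletal IsOrderedPartition
  orderedPartition-skeletal {S} {S′} same (once , increasing) =
    once′ , subst (Linked _<_) (sym (map-skeletal (minB ∘ proj₁) same)) increasing
    where
    member? : ∀ v → Decidable (λ (s : Skeleton N) → memB (proj₁ s) v ≡ true)
    member? v s = memB (proj₁ s) v Bool.≟ true
    once′ : ∀ v → 1 ≤ v → v ≤ N → length (filter (member? v ∘ skeleton) S) ≡ 1
    once′ v 1≤v v≤N = begin
      length (filter (member? v ∘ skeleton) S)      ≡⟨ length-filter-map (member? v) skeleton S ⟩
      length (filter (member? v) (map skeleton S))  ≡⟨ cong (length ∘ filter (member? v)) same ⟩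
      length (filter (member? v) (map skeleton S′)) ≡⟨ length-filter-map (member? v) skeleton S′ ⟨
      length (filter (member? v ∘ skeleton) S′)     ≡⟨ once v 1≤v v≤N ⟩
      1                                             ∎
      where open ≡.≡-Reasoning

-- Walks, cycles and trees in a graph

module Graph (ord : List Edge) {N : ℕ} (graph : IsGraph N ord) where

  M : ℕ
  M = m ord

  Walk : Subset M → ℕ → ℕ → Set
  Walk = Reach ord {N}

  Link : Fin M → ℕ → ℕ → Set
  Link p = Joins ord (edgeAt ord p)

  end₁ end₂ : Fin M → ℕ
  end₁ p = proj₁ (edgeAt ord p)
  end₂ p = proj₂ (edgeAt ord p)

  link-ends : ∀ p → Link p (end₁ p) (end₂ p)
  link-ends p = inj₁ refl

  end₁<end₂ : ∀ p → end₁ p < end₂ p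
  end₁<end₂ p = proj₁ (proj₂ (All.lookup (proj₁ graph) (∈-lookup p)))

  link-sym : ∀ {p u w} → Link p u w → Link p w u
  link-sym (inj₁ e) = inj₂ e
  link-sym (inj₂ e) = inj₁ e

  link-irreflexive : ∀ {p u w} → Link p u w → u ≢ w
  link-irreflexive {p} (inj₁ refl) e = ℕ.<-irrefl e (end₁<end₂ p)
  link-irreflexive {p} (inj₂ refl) e = ℕ.<-irrefl (sym e) (end₁<end₂ p)

  link? : ∀ p u w → Dec (Link p u w)
  link? p u w = ×-≡-dec ℕ._≟_ ℕ._≟_ (edgeAt ord p) (u , w) ⊎-dec ×-≡-dec ℕ._≟_ ℕ._≟_ (edgeAt ord p) (w , u)

  -- Edges are stored as pairs (a , b) with a < b, without repetition.
  link-unique : ∀ {p q u w} → Link p u w → Link q u w → p ≡ q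
  link-unique (inj₁ e) (inj₁ e′) = lookup-injective (proj₂ graph) (trans e (sym e′))
  link-unique (inj₂ e) (inj₂ e′) = lookup-injective (proj₂ graph) (trans e (sym e′))
  link-unique {p} {q} (inj₁ refl) (inj₂ e′) =
    ⊥-elim (ℕ.<-asym (end₁<end₂ p) (subst (λ e → proj₁ e < proj₂ e) e′ (end₁<end₂ q)))
  link-unique {p} {q} (inj₂ refl) (inj₁ e′) =
    ⊥-elim (ℕ.<-asym (end₁<end₂ p) (subst (λ e → proj₁ e < proj₂ e) e′ (end₁<end₂ q)))

  link-ends-cases : ∀ {p u w} → Link p u w → (u ≡ end₁ p × w ≡ end₂ p) ⊎ (u ≡ end₂ p × w ≡ end₁ p)
  link-ends-cases (inj₁ refl) = inj₁ (refl , refl)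
  link-ends-cases (inj₂ refl) = inj₂ (refl , refl)

  walk-++ : ∀ {F u w v} → Walk F u w → Walk F w v → Walk F u v
  walk-++ here r′ = r′
  walk-++ (step p p∈ l r) r′ = step p p∈ l (walk-++ r r′)

  walk-edge : ∀ {F p u w} → p ∈ₛ F → Link p u w → Walk F u w
  walk-edge {p = p} p∈ l = step p p∈ l here

  walk-reverse : ∀ {F u v} → Walk F u v → Walk F v u
  walk-reverse here = here
  walk-reverse (step p p∈ l r) = walk-++ (walk-reverse r) (walk-edge p∈ (link-sym l))

  walk-mono : ∀ {F G u v} → F Subset.⊆ G → Walk F u v → Walk G u v
  walk-mono F⊆G here = here
  walk-mono F⊆G (step p p∈ l r) = step p (F⊆G p∈) l (walk-mono F⊆G r)

  walk-empty : ∀ {F u v} → Subset.Empty F → Walk F u v → u ≡ v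
  walk-empty ∅ here = refl
  walk-empty ∅ (step p p∈ _ _) = contradiction (p , p∈) ∅

  Detour : Fin M → Subset M → ℕ → ℕ → Set
  Detour e G u v = (Walk G u (end₁ e) × Walk G (end₂ e) v) ⊎ (Walk G u (end₂ e) × Walk G (end₁ e) v)

  walk-split : ∀ {F e u v} → e ∈ₛ F → Walk F u v → Walk (F - e) u v ⊎ Detour e (F - e) u v
  walk-split e∈ here = inj₁ here
  walk-split {e = e} e∈ (step p p∈ l r) with p Fin.≟ e | walk-split e∈ r
  ... | no p≢e | inj₁ r′ = inj₁ (step p (x∈p∧x≢y⇒x∈p-y p∈ p≢e) l r′)
  ... | no p≢e | inj₂ (inj₁ (r₁ , r₂)) = inj₂ (inj₁ (step p (x∈p∧x≢y⇒x∈p-y p∈ p≢e) l r₁ , r₂))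
  ... | no p≢e | inj₂ (inj₂ (r₁ , r₂)) = inj₂ (inj₂ (step p (x∈p∧x≢y⇒x∈p-y p∈ p≢e) l r₁ , r₂))
  ... | yes refl | rest = through l rest
    where
    through : ∀ {G u w v} → Link e u w → Walk G w v ⊎ Detour e G w v → Walk G u v ⊎ Detour e G u v
    through (inj₁ refl) (inj₁ r′) = inj₂ (inj₁ (here , r′))
    through (inj₁ refl) (inj₂ (inj₁ (_ , r₂))) = inj₂ (inj₁ (here , r₂))
    through (inj₁ refl) (inj₂ (inj₂ (_ , r₂))) = inj₁ r₂
    through (inj₂ refl) (inj₁ r′) = inj₂ (inj₂ (here , r′))
    through (inj₂ refl) (inj₂ (inj₁ (_ , r₂))) = inj₁ r₂
    through (inj₂ refl) (inj₂ (inj₂ (_ , r₂))) = inj₂ (inj₂ (here , r₂))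

  walk-join : ∀ {F e u v} → e ∈ₛ F → Walk (F - e) u v ⊎ Detour e (F - e) u v → Walk F u v
  walk-join {F} {e} e∈ = [ lift , [ uncurry (via (link-ends e)) , uncurry (via (link-sym (link-ends e))) ] ]
    where
    lift : ∀ {u v} → Walk (F - e) u v → Walk F u v
    lift = walk-mono (p─q⊆p F _)
    via : ∀ {u x y v} → Link e x y → Walk (F - e) u x → Walk (F - e) y v → Walk F u v
    via l r₁ r₂ = walk-++ (lift r₁) (walk-++ (walk-edge e∈ l) (lift r₂))

  -- Deleting one edge at a time decides reachability.
  walk? : ∀ F u v → Dec (Walk F u v)
  walk? F = bounded ∣ F ∣ F ℕ.≤-refl
    where
    bounded : ∀ k F → ∣ F ∣ ≤ k → ∀ u v → Dec (Walk F u v)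
    bounded k F _ u v with nonempty? F
    ... | no ∅ = map′ (λ { refl → here }) (walk-empty ∅) (u ℕ.≟ v)
    bounded zero F ∣F∣≤0 u v | yes (e , e∈) = ⊥-elim (ℕ.n≮0 (ℕ.<-≤-trans (x∈p⇒∣p-x∣<∣p∣ e∈) ∣F∣≤0))
    bounded (suc k) F ∣F∣≤ u v | yes (e , e∈) =
      map′ (walk-join e∈) (walk-split e∈)
           (W? u v ⊎-dec ((W? u (end₁ e) ×-dec W? (end₂ e) v) ⊎-dec (W? u (end₂ e) ×-dec W? (end₁ e) v)))
      where
      W? = bounded k (F - e) (ℕ.≤-pred (ℕ.<-≤-trans (x∈p⇒∣p-x∣<∣p∣ e∈) ∣F∣≤))

  later : ∀ {F u v} → Walk F u v → List ℕ
  later here = []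
  later (step {w = w} _ _ _ r) = w ∷ later r

  lastOf-later : ∀ {F u v} (r : Walk F u v) → lastOf u (later r) ≡ v
  lastOf-later here = refl
  lastOf-later (step _ _ _ r) = lastOf-later r

  walk-steps : ∀ {F u v} (r : Walk F u v) {π} → π ∈ pathPairs u (later r) →
               ∃ λ p → p ∈ₛ F × Link p (proj₁ π) (proj₂ π)
  walk-steps (step p p∈ l r) (here refl) = p , p∈ , l
  walk-steps (step p p∈ l r) (there π∈) = walk-steps r π∈

  IsPath : ∀ {F u v} → Walk F u v → Set
  IsPath {u = u} r = Unique (u ∷ later r)

  walk-from : ∀ {F u w v} (r : Walk F w v) → u ∈ w ∷ later r →
              Σ (Walk F u v) λ r′ → IsPath r → IsPath r′
  walk-from r (here refl) = r , id
  walk-from (step p p∈ l r) (there u∈) with walk-from r u∈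
  ... | r′ , path = r′ , λ { (_ ∷ u) → path u }

  walk⇒path : ∀ {F u v} → Walk F u v → Σ (Walk F u v) IsPath
  walk⇒path here = here , [] ∷ []
  walk⇒path {u = u} (step p p∈ l r) with walk⇒path r
  ... | r′ , path with u ∈? _ ∷ later r′
  ...   | yes u∈ = let (r″ , path′) = walk-from r′ u∈ in r″ , path′ path
  ...   | no u∉ = step p p∈ l r′ , All.¬Any⇒All¬ _ u∉ ∷ path

  cyclePairs-∷ : ∀ a l → cyclePairs ord (a ∷ l) ≡ pathPairs a l ∷ʳ (lastOf a l , a)
  cyclePairs-∷ a l = zip-∷ʳ≡pathPairs a l a

  cyclePairs-rotate : ∀ vs → cyclePairs ord (rotate vs) ≡ rotate (cyclePairs ord vs)
  cyclePairs-rotate [] = refl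
  cyclePairs-rotate (a ∷ []) = refl
  cyclePairs-rotate (a ∷ b ∷ l) = begin
    cyclePairs ord (b ∷ l ∷ʳ a)                          ≡⟨ cyclePairs-∷ b (l ∷ʳ a) ⟩
    pathPairs b (l ∷ʳ a) ∷ʳ (lastOf b (l ∷ʳ a) , b)      ≡⟨ cong₂ (λ ps z → ps ∷ʳ (z , b)) (pathPairs-∷ʳ b l a) (lastOf-∷ʳ b l a) ⟩
    (pathPairs b l ∷ʳ (lastOf b l , a)) ∷ʳ (a , b)       ≡⟨ cong (_∷ʳ (a , b)) (sym (zip-∷ʳ≡pathPairs b l a)) ⟩
    rotate (cyclePairs ord (a ∷ b ∷ l))                   ∎
    where open ≡.≡-Reasoning

  cyclePairs-rotate^ : ∀ k vs → cyclePairs ord (rotate^ k vs) ≡ rotate^ k (cyclePairs ord vs)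
  cyclePairs-rotate^ zero vs = refl
  cyclePairs-rotate^ (suc k) vs = trans (cyclePairs-rotate^ k (rotate vs)) (cong (rotate^ k) (cyclePairs-rotate vs))

  -- Any step π of a closed vertex sequence can be made its closing step by a rotation.
  open-cycle : ∀ {vs π} → Unique vs → π ∈ cyclePairs ord vs →
    ∃₂ λ h t → Unique (h ∷ t) × length (h ∷ t) ≡ length vs ×
               (∀ {π′} → π′ ∈ pathPairs h t → π′ ∈ cyclePairs ord vs) × π ≡ (lastOf h t , h)
  open-cycle {vs} {π} u π∈ with rotate-to-end π∈
  ... | k , ys , e with rotate^ k vs in ws≡
  ...   | [] = case List.++-conicalʳ ys (π ∷ []) (trans (sym e) (trans (sym (cyclePairs-rotate^ k vs)) (cong (cyclePairs ord) ws≡))) of λ ()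
  ...   | h ∷ t = h , t , Unique-↭ (subst (vs ↭_) ws≡ (↭-sym (rotate^-↭ k vs))) u
                  , trans (cong length (sym ws≡)) (↭-length (rotate^-↭ k vs))
                  , (λ {π′} π′∈ → ∈-resp-↭ (rotate^-↭ k (cyclePairs ord vs)) (subst (π′ ∈_) pairs≡ (∈-++⁺ˡ π′∈)))
                  , sym (List.∷ʳ-injectiveʳ (pathPairs h t) ys (trans pairs≡ e))
    where
    pairs≡ : pathPairs h t ∷ʳ (lastOf h t , h) ≡ rotate^ k (cyclePairs ord vs)
    pairs≡ = trans (sym (cyclePairs-∷ h t)) (trans (cong (cyclePairs ord) (sym ws≡)) (cyclePairs-rotate^ k vs))

  LinksStepOf : List ℕ → Fin M → Set
  LinksStepOf vs p = Any (λ π → Link p (proj₁ π) (proj₂ π)) (cyclePairs ord vs)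

  linksStepOf? : ∀ vs → Decidable (LinksStepOf vs)
  linksStepOf? vs p = Any.any? (λ π → link? p (proj₁ π) (proj₂ π)) (cyclePairs ord vs)

  cycleEdges : List ℕ → Subset M
  cycleEdges vs = select (linksStepOf? vs)

  ∈-cycleEdges⁺ : ∀ {vs p π} → π ∈ cyclePairs ord vs → Link p (proj₁ π) (proj₂ π) → p ∈ₛ cycleEdges vs
  ∈-cycleEdges⁺ {vs} π∈ l = ∈-select⁺ (linksStepOf? vs) (lose π∈ l)

  ∈-cycleEdges⁻ : ∀ {vs p} → p ∈ₛ cycleEdges vs →
                  Σ (ℕ × ℕ) λ π → π ∈ cyclePairs ord vs × Link p (proj₁ π) (proj₂ π)
  ∈-cycleEdges⁻ {vs} p∈ = find (∈-select⁻ (linksStepOf? vs) p∈)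

  cycleEdges-isCycle : ∀ {vs} → 3 ≤ length vs → Unique vs →
    (∀ {π} → π ∈ cyclePairs ord vs → ∃ λ p → Link p (proj₁ π) (proj₂ π)) → IsCycleEdgeSet ord (cycleEdges vs)
  cycleEdges-isCycle {vs} 3≤ u linked = vs , 3≤ , u , linked , (λ _ → ∈-cycleEdges⁻) , (λ _ _ → ∈-cycleEdges⁺)

  cyclePairs-walk⁻ : ∀ {F u v} (r : Walk F u v) {π} → π ∈ cyclePairs ord (u ∷ later r) →
                     π ∈ pathPairs u (later r) ⊎ π ≡ (v , u)
  cyclePairs-walk⁻ {u = u} r π∈
    with ∈-++⁻ (pathPairs u (later r)) (subst (_ ∈_) (trans (cyclePairs-∷ u (later r)) (cong (λ z → pathPairs u (later r) ∷ʳ (z , u)) (lastOf-later r))) π∈)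
  ... | inj₁ π∈′ = inj₁ π∈′
  ... | inj₂ (here refl) = inj₂ refl

  cyclePairs-walk-closing : ∀ {F u v} (r : Walk F u v) → (v , u) ∈ cyclePairs ord (u ∷ later r)
  cyclePairs-walk-closing {u = u} r =
    subst ((_ , u) ∈_) (sym (cyclePairs-∷ u (later r))) (∈-++⁺ʳ (pathPairs u (later r)) (here (cong (_, u) (sym (lastOf-later r)))))

  walk-avoiding-two-steps : ∀ {G q u v} → q ∉ₛ G → Link q u v → (r : Walk G u v) → 2 ≤ length (later r)
  walk-avoiding-two-steps q∉ lq here = ⊥-elim (link-irreflexive lq refl)
  walk-avoiding-two-steps q∉ lq (step p p∈ l here) = contradiction (subst (_∈ₛ _) (link-unique l lq) p∈) q∉
  walk-avoiding-two-steps q∉ lq (step _ _ _ (step _ _ _ _)) = s≤s (s≤s z≤n)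

  -- The cycle is a path between the ends of q, closed up by q.
  cycle-through : ∀ {G q} → q ∉ₛ G → Walk G (end₁ q) (end₂ q) →
    Σ (Subset M) λ C → IsCycleEdgeSet ord C × q ∈ₛ C × (∀ p → p ∈ₛ C → p ≢ q → p ∈ₛ G)
  cycle-through {G} {q} q∉ w with walk⇒path w
  ... | r , path = cycleEdges vs , cycleEdges-isCycle (s≤s (walk-avoiding-two-steps q∉ (link-ends q) r)) path linked
                 , ∈-cycleEdges⁺ (cyclePairs-walk-closing r) (link-sym (link-ends q)) , inG
    where
    vs = end₁ q ∷ later r
    linked : ∀ {π} → π ∈ cyclePairs ord vs → ∃ λ p → Link p (proj₁ π) (proj₂ π)
    linked π∈ with cyclePairs-walk⁻ r π∈
    ... | inj₁ π∈′ = let (p , _ , l) = walk-steps r π∈′ in p , l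
    ... | inj₂ refl = q , link-sym (link-ends q)
    inG : ∀ p → p ∈ₛ cycleEdges vs → p ≢ q → p ∈ₛ G
    inG p p∈ p≢q with ∈-cycleEdges⁻ p∈
    ... | π , π∈ , l with cyclePairs-walk⁻ r π∈
    ...   | inj₁ π∈′ = let (p′ , p′∈ , l′) = walk-steps r π∈′ in subst (_∈ₛ G) (link-unique l′ l) p′∈
    ...   | inj₂ refl = contradiction (link-unique l (link-sym (link-ends q))) p≢q

  link-same-edge : ∀ {q u w x y} → Link q u w → Link q x y → (x , y) ≡ (u , w) ⊎ (x , y) ≡ (w , u)
  link-same-edge (inj₁ refl) (inj₁ refl) = inj₁ refl
  link-same-edge (inj₁ refl) (inj₂ refl) = inj₂ refl
  link-same-edge (inj₂ refl) (inj₁ refl) = inj₂ refl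
  link-same-edge (inj₂ refl) (inj₂ refl) = inj₁ refl

  walk-along : ∀ {G} h t → (∀ {π} → π ∈ pathPairs h t → ∃ λ p → p ∈ₛ G × Link p (proj₁ π) (proj₂ π)) →
               Walk G h (lastOf h t)
  walk-along h [] steps = here
  walk-along h (b ∷ t) steps =
    let (p , p∈ , l) = steps (here refl) in step p p∈ l (walk-along b t (steps ∘ there))

  walk-between-ends : ∀ {G q u w} → Link q u w → Walk G u w → Walk G (end₁ q) (end₂ q)
  walk-between-ends l r with link-ends-cases l
  ... | inj₁ (refl , refl) = r
  ... | inj₂ (refl , refl) = walk-reverse r

  below : Subset M → Fin M → Subset M
  below F q = F Subset.∩ select (Fin._<? q)

  ∈-below⁺ : ∀ {F p q} → p ∈ₛ F → p Fin.< q → p ∈ₛ below F q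
  ∈-below⁺ {q = q} p∈ p<q = Subset.x∈p∩q⁺ (p∈ , ∈-select⁺ (Fin._<? q) p<q)

  ∈-below⁻ : ∀ {F q p} → p ∈ₛ below F q → p ∈ₛ F × p Fin.< q
  ∈-below⁻ {F} {q} p∈ = let (p∈F , p∈<) = Subset.x∈p∩q⁻ F _ p∈ in p∈F , ∈-select⁻ (Fin._<? q) p∈<

  Bad : Subset M → Fin M → Set
  Bad F q = Walk (below F q) (end₁ q) (end₂ q)

  bad? : ∀ F → Decidable (Bad F)
  bad? F q = walk? (below F q) (end₁ q) (end₂ q)

  firstBad : Subset M → Maybe (Fin M)
  firstBad F = first (bad? F)

  below-toggle : ∀ {F p q x} → p Fin.≤ q → x ∈ₛ below (toggle q F) p ⇔ x ∈ₛ below F p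
  below-toggle {F} {p} {q} {x} p≤q = mk⇔
    (λ x∈ → let (x∈F , x<p) = ∈-below⁻ {toggle q F} {p} x∈ in ∈-below⁺ (Equivalence.to (∈-toggle-≢ (x≢q x<p)) x∈F) x<p)
    (λ x∈ → let (x∈F , x<p) = ∈-below⁻ {F} {p} x∈ in ∈-below⁺ (Equivalence.from (∈-toggle-≢ {F = F} (x≢q x<p)) x∈F) x<p)
    where
    x≢q : x Fin.< p → x ≢ q
    x≢q x<p refl = ℕ.<-irrefl refl (ℕ.<-≤-trans x<p p≤q)

  Bad-toggle : ∀ {F p q} → p Fin.≤ q → Bad (toggle q F) p ⇔ Bad F p
  Bad-toggle p≤q = mk⇔ (walk-mono (Equivalence.to (below-toggle p≤q))) (walk-mono (Equivalence.from (below-toggle p≤q)))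

  firstBad-toggle : ∀ {F q} → firstBad F ≡ just q → firstBad (toggle q F) ≡ just q
  firstBad-toggle {F} {q} e with first-just (bad? F) e
  ... | bad , least = first-least (bad? (toggle q F))
    (Equivalence.from (Bad-toggle ℕ.≤-refl) bad)
    (λ p p<q → least p p<q ∘ Equivalence.to (Bad-toggle (ℕ.<⇒≤ p<q)))

  walk-start-∈ : ∀ {V F u v} → IsSubgraph ord {N} V F → Walk F u v → u ≢ v → u ∈ᵥ V
  walk-start-∈ {V} sub here u≢v = contradiction refl u≢v
  walk-start-∈ {V} sub (step p p∈ (inj₁ refl) r) _ = proj₁ (sub p p∈)
  walk-start-∈ {V} sub (step p p∈ (inj₂ refl) r) _ = proj₂ (sub p p∈)

  toggle-connected : ∀ {V F q} → Bad F q → IsConnectedSubgraph ord {N} V F → IsConnectedSubgraph ord {N} V (toggle q F)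
  toggle-connected {V} {F} {q} bad (sub , conn) = sub′ , conn′
    where
    below⊆toggle : below F q Subset.⊆ toggle q F
    below⊆toggle x∈ = let (x∈F , x<q) = ∈-below⁻ {F} {q} x∈ in Equivalence.from (∈-toggle-≢ (Fin.<⇒≢ x<q)) x∈F
    ends-joined : Walk F (end₁ q) (end₂ q)
    ends-joined = walk-mono (proj₁ ∘ ∈-below⁻ {F} {q}) bad
    end₁≢end₂ : end₁ q ≢ end₂ q
    end₁≢end₂ = link-irreflexive (link-ends q)
    sub′ : IsSubgraph ord {N} V (toggle q F)
    sub′ p p∈ with p Fin.≟ q
    ... | yes refl = walk-start-∈ {V} sub ends-joined end₁≢end₂ , walk-start-∈ {V} sub (walk-reverse ends-joined) (end₁≢end₂ ∘ sym)
    ... | no p≢q = sub p (Equivalence.to (∈-toggle-≢ p≢q) p∈)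
    detour : ∀ {u w} → Link q u w → Walk (toggle q F) u w
    detour l with link-ends-cases l
    ... | inj₁ (refl , refl) = walk-mono below⊆toggle bad
    ... | inj₂ (refl , refl) = walk-reverse (walk-mono below⊆toggle bad)
    bypass : ∀ {u v} → Walk F u v → Walk (toggle q F) u v
    bypass here = here
    bypass (step p p∈ l r) with p Fin.≟ q
    ... | yes refl = walk-++ (detour l) (bypass r)
    ... | no p≢q = step p (Equivalence.from (∈-toggle-≢ p≢q) p∈) l (bypass r)
    conn′ : ∀ u v → u ∈ᵥ V → v ∈ᵥ V → Walk (toggle q F) u v
    conn′ u v u∈ v∈ = bypass (conn u v u∈ v∈)

  Acyclic : Subset M → Set
  Acyclic F = ∀ C → IsCycleEdgeSet ord C → ¬ (∀ p → p ∈ₛ C → p ∈ₛ F)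

  acyclic-mono : ∀ {F G} → G Subset.⊆ F → Acyclic F → Acyclic G
  acyclic-mono G⊆F acyclic C cycle C⊆G = acyclic C cycle (λ p p∈ → G⊆F (C⊆G p p∈))

  NBC⇒no-bad : ∀ {F} → (∀ C → IsCycleEdgeSet ord C → ¬ BrokenCircuitIn ord C F) → ∀ q → ¬ Bad F q
  NBC⇒no-bad {F} nbc q bad with cycle-through (λ q∈ → Fin.<-irrefl refl (proj₂ (∈-below⁻ {F} {q} q∈))) bad
  ... | C , cycle , q∈C , C-q⊆ = nbc C cycle (q , q∈C , max , λ p p∈ p≢q → proj₁ (∈-below⁻ {F} {q} (C-q⊆ p p∈ p≢q)))
    where
    max : ∀ p → p ∈ₛ C → toℕ p ≤ toℕ q
    max p p∈ with p Fin.≟ q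
    ... | yes refl = ℕ.≤-refl
    ... | no p≢q = ℕ.<⇒≤ (proj₂ (∈-below⁻ {F} {q} (C-q⊆ p p∈ p≢q)))

  no-bad⇒no-broken-circuit : ∀ {F} → (∀ q → ¬ Bad F q) → ∀ C → IsCycleEdgeSet ord C → ¬ BrokenCircuitIn ord C F
  no-bad⇒no-broken-circuit {F} no-bad C (vs , 3≤ , u , linked , C-links , links-C) (q , q∈C , max , C-q⊆F)
    with C-links q q∈C
  ... | uw , uw∈ , lq with open-cycle u uw∈
  ...   | h , t , u′ , length≡ , ⊆vs , refl = no-bad q (walk-between-ends (link-sym lq) (walk-along h t steps))
    where
    steps : ∀ {π} → π ∈ pathPairs h t → ∃ λ p → p ∈ₛ below F q × Link p (proj₁ π) (proj₂ π)
    steps {π} π∈ with linked (⊆vs π∈)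
    ... | p , lp with p Fin.≟ q
    ...   | no p≢q = p , ∈-below⁺ (C-q⊆F p p∈C p≢q) (Fin.≤∧≢⇒< (max p p∈C) p≢q) , lp
      where p∈C = links-C p π (⊆vs π∈) lp
    ...   | yes refl with link-same-edge lq lp | pathPairs-avoid-ends h t u′ (ℕ.≤-pred (subst (3 ≤_) (sym length≡) 3≤)) π∈
    ...     | inj₁ π≡ | ≢closing , _ = contradiction π≡ ≢closing
    ...     | inj₂ π≡ | _ , ≢reversed = contradiction π≡ ≢reversed

  no-bad⇒NBC : ∀ {V F} → IsConnectedSubgraph ord {N} V F → (∀ q → ¬ Bad F q) → IsNBCTree ord {N} V F
  no-bad⇒NBC {V} {F} connected no-bad = (connected , acyclic) , no-bad⇒no-broken-circuit no-bad
    where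
    acyclic : Acyclic F
    acyclic C (_ ∷ [] , s≤s () , _) _
    acyclic C cycle@(a ∷ b ∷ _ , _ , _ , linked , _ , links-C) C⊆F =
      let (p , lp) = linked (here refl)
          (q , q∈C , max) = max-∈ (links-C p _ (here refl) lp)
      in no-bad⇒no-broken-circuit no-bad C cycle (q , q∈C , max , λ p p∈ _ → C⊆F p p∈)

  -- Deleting an edge e = {a , b} of a tree leaves two trees: the parts reachable from a and from b.
  module Deletion {V F} (tree : IsTree ord {N} V F) {e} (e∈F : e ∈ₛ F) where

    F′ : Subset M
    F′ = F - e

    side : ℕ → Subset N
    side c = V Subset.∩ select (λ i → walk? F′ c (vertex i))

    sideEdges : ℕ → Subset M
    sideEdges c = F′ Subset.∩ select (λ p → walk? F′ c (end₁ p))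

    private
      sub = proj₁ (proj₁ tree)
      conn = proj₂ (proj₁ tree)
      acyclic = proj₂ tree

    ∈-side⁻ : ∀ {c i} → i ∈ₛ side c → i ∈ₛ V × Walk F′ c (vertex i)
    ∈-side⁻ {c} i∈ = let (i∈V , i∈R) = Subset.x∈p∩q⁻ V _ i∈ in i∈V , ∈-select⁻ (λ i → walk? F′ c (vertex i)) i∈R

    ∈-side⁺ : ∀ {c i} → i ∈ₛ V → Walk F′ c (vertex i) → i ∈ₛ side c
    ∈-side⁺ {c} i∈V r = Subset.x∈p∩q⁺ (i∈V , ∈-select⁺ (λ i → walk? F′ c (vertex i)) r)

    ∈ᵥ-side⁻ : ∀ {c v} → v ∈ᵥ side c → v ∈ᵥ V × Walk F′ c v
    ∈ᵥ-side⁻ {c} v∈ with ∈ᵥ⇒vertex {V = side c} v∈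
    ... | i , refl = let (i∈V , r) = ∈-side⁻ (Equivalence.to ∈ᵥ⇔∈ₛ v∈) in Equivalence.from ∈ᵥ⇔∈ₛ i∈V , r

    ∈ᵥ-side⁺ : ∀ {c v} → v ∈ᵥ V → Walk F′ c v → v ∈ᵥ side c
    ∈ᵥ-side⁺ v∈ r with ∈ᵥ⇒vertex {V = V} v∈
    ... | i , refl = Equivalence.from ∈ᵥ⇔∈ₛ (∈-side⁺ (Equivalence.to ∈ᵥ⇔∈ₛ v∈) r)

    ∈-sideEdges⁻ : ∀ {c p} → p ∈ₛ sideEdges c → p ∈ₛ F′ × Walk F′ c (end₁ p)
    ∈-sideEdges⁻ {c} p∈ = let (p∈F′ , p∈R) = Subset.x∈p∩q⁻ F′ _ p∈ in p∈F′ , ∈-select⁻ (λ p → walk? F′ c (end₁ p)) p∈R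

    ∈-sideEdges⁺ : ∀ {c p} → p ∈ₛ F′ → Walk F′ c (end₁ p) → p ∈ₛ sideEdges c
    ∈-sideEdges⁺ {c} p∈F′ r = Subset.x∈p∩q⁺ (p∈F′ , ∈-select⁺ (λ p → walk? F′ c (end₁ p)) r)

    F′⊆F : F′ Subset.⊆ F
    F′⊆F = p─q⊆p F _

    reached-from-an-end : ∀ {v} → v ∈ᵥ V → Walk F′ (end₁ e) v ⊎ Walk F′ (end₂ e) v
    reached-from-an-end v∈ with walk-split e∈F (conn _ _ (proj₁ (sub e e∈F)) v∈)
    ... | inj₁ r = inj₁ r
    ... | inj₂ (inj₁ (_ , r)) = inj₂ r
    ... | inj₂ (inj₂ (_ , r)) = inj₁ r

    not-reached-from-both : ∀ {v} → Walk F′ (end₁ e) v → Walk F′ (end₂ e) v → ⊥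
    not-reached-from-both r₁ r₂ with cycle-through (x∉p-x F e) (walk-++ r₁ (walk-reverse r₂))
    ... | C , cycle , e∈C , C-e⊆F′ = acyclic C cycle inF
      where
      inF : ∀ p → p ∈ₛ C → p ∈ₛ F
      inF p p∈ with p Fin.≟ e
      ... | yes refl = e∈F
      ... | no p≢e = F′⊆F (C-e⊆F′ p p∈ p≢e)

    side-tree : ∀ {c} → c ∈ᵥ V → IsTree ord {N} (side c) (sideEdges c)
    side-tree {c} c∈ = (sub′ , conn′) , acyclic-mono (F′⊆F ∘ proj₁ ∘ ∈-sideEdges⁻) acyclic
      where
      sub′ : IsSubgraph ord {N} (side c) (sideEdges c)
      sub′ p p∈ = let (p∈F′ , r) = ∈-sideEdges⁻ p∈ ; (end₁∈ , end₂∈) = sub p (F′⊆F p∈F′) in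
        ∈ᵥ-side⁺ end₁∈ r , ∈ᵥ-side⁺ end₂∈ (walk-++ r (walk-edge p∈F′ (link-ends p)))
      stay : ∀ {x y} → Walk F′ c x → Walk F′ x y → Walk (sideEdges c) x y
      stay r here = here
      stay r (step p p∈ l r′) with link-ends-cases l
      ... | inj₁ (refl , refl) = step p (∈-sideEdges⁺ p∈ r) l (stay (walk-++ r (walk-edge p∈ l)) r′)
      ... | inj₂ (refl , refl) = step p (∈-sideEdges⁺ p∈ (walk-++ r (walk-edge p∈ l))) l (stay (walk-++ r (walk-edge p∈ l)) r′)
      conn′ : ∀ u v → u ∈ᵥ side c → v ∈ᵥ side c → Walk (sideEdges c) u v
      conn′ u v u∈ v∈ = walk-++ (walk-reverse (stay here (proj₂ (∈ᵥ-side⁻ u∈)))) (stay here (proj₂ (∈ᵥ-side⁻ v∈)))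

    vertices-split : ∀ {i} → i ∈ₛ V ⇔ (i ∈ₛ side (end₁ e) ⊎ i ∈ₛ side (end₂ e))
    vertices-split = mk⇔
      (λ i∈ → Sum.map (∈-side⁺ i∈) (∈-side⁺ i∈) (reached-from-an-end (Equivalence.from ∈ᵥ⇔∈ₛ i∈)))
      [ proj₁ ∘ ∈-side⁻ , proj₁ ∘ ∈-side⁻ ]

    sides-disjoint : ∀ {i} → i ∈ₛ side (end₁ e) → i ∉ₛ side (end₂ e)
    sides-disjoint i∈₁ i∈₂ = not-reached-from-both (proj₂ (∈-side⁻ i∈₁)) (proj₂ (∈-side⁻ i∈₂))

    edges-split : ∀ {p} → p ∈ₛ F′ ⇔ (p ∈ₛ sideEdges (end₁ e) ⊎ p ∈ₛ sideEdges (end₂ e))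
    edges-split {p} = mk⇔
      (λ p∈ → Sum.map (∈-sideEdges⁺ p∈) (∈-sideEdges⁺ p∈) (reached-from-an-end (proj₁ (sub p (F′⊆F p∈)))))
      [ proj₁ ∘ ∈-sideEdges⁻ , proj₁ ∘ ∈-sideEdges⁻ ]

    sideEdges-disjoint : ∀ {p} → p ∈ₛ sideEdges (end₁ e) → p ∉ₛ sideEdges (end₂ e)
    sideEdges-disjoint p∈₁ p∈₂ = not-reached-from-both (proj₂ (∈-sideEdges⁻ p∈₁)) (proj₂ (∈-sideEdges⁻ p∈₂))

    ∣F∣≡ : ∣ F ∣ ≡ suc (∣ sideEdges (end₁ e) ∣ + ∣ sideEdges (end₂ e) ∣)
    ∣F∣≡ = begin
      ∣ F ∣                                                 ≡⟨ ∣∣-partition F⇔ (λ p∈F′ p∈⁅e⁆ → x∉p-x F e (subst (_∈ₛ F′) (Subset.x∈⁅y⁆⇒x≡y e p∈⁅e⁆) p∈F′)) ⟩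
      ∣ F′ ∣ + ∣ Subset.⁅ e ⁆ ∣                             ≡⟨ cong₂ _+_ (∣∣-partition edges-split sideEdges-disjoint) (Subset.∣⁅x⁆∣≡1 e) ⟩
      ∣ sideEdges (end₁ e) ∣ + ∣ sideEdges (end₂ e) ∣ + 1   ≡⟨ ℕ.+-comm _ 1 ⟩
      suc (∣ sideEdges (end₁ e) ∣ + ∣ sideEdges (end₂ e) ∣) ∎
      where
      open ≡.≡-Reasoning
      F⇔ : ∀ {p} → p ∈ₛ F ⇔ (p ∈ₛ F′ ⊎ p ∈ₛ Subset.⁅ e ⁆)
      F⇔ {p} = mk⇔
        (λ p∈ → case p Fin.≟ e of λ { (yes refl) → inj₂ (Subset.x∈⁅x⁆ e) ; (no p≢e) → inj₁ (x∈p∧x≢y⇒x∈p-y p∈ p≢e) })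
        [ F′⊆F , (λ p∈⁅e⁆ → subst (_∈ₛ F) (sym (Subset.x∈⁅y⁆⇒x≡y e p∈⁅e⁆)) e∈F) ]

  tree-size : ∀ {V F} → IsTree ord {N} V F → Nonempty V → suc ∣ F ∣ ≡ ∣ V ∣
  tree-size {F = F} = go ∣ F ∣ ℕ.≤-refl
    where
    go : ∀ k {V F} → ∣ F ∣ ≤ k → IsTree ord {N} V F → Nonempty V → suc ∣ F ∣ ≡ ∣ V ∣
    go k {V} {F} _ tree (i₀ , i₀∈) with nonempty? F
    ... | no ∅ = begin
      suc ∣ F ∣            ≡⟨ cong (suc ∘ ∣_∣) (Subset.Empty-unique ∅) ⟩
      suc ∣ Subset.⊥ {M} ∣ ≡⟨ cong suc (Subset.∣⊥∣≡0 M) ⟩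
      1                    ≡⟨ sym (Subset.∣⁅x⁆∣≡1 i₀) ⟩
      ∣ Subset.⁅ i₀ ⁆ ∣    ≡⟨ cong ∣_∣ (Subset.⊆-antisym ⁅i₀⁆⊆V V⊆⁅i₀⁆) ⟩
      ∣ V ∣                ∎
      where
      open ≡.≡-Reasoning
      V⊆⁅i₀⁆ : V Subset.⊆ Subset.⁅ i₀ ⁆
      V⊆⁅i₀⁆ {i} i∈ = subst (Subset._∈ Subset.⁅ i₀ ⁆) (sym (Fin.toℕ-injective (ℕ.suc-injective
        (walk-empty ∅ (proj₂ (proj₁ tree) _ _ (Equivalence.from ∈ᵥ⇔∈ₛ i∈) (Equivalence.from ∈ᵥ⇔∈ₛ i₀∈))))))
        (Subset.x∈⁅x⁆ i₀)
      ⁅i₀⁆⊆V : Subset.⁅ i₀ ⁆ Subset.⊆ V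
      ⁅i₀⁆⊆V i∈ = subst (_∈ₛ V) (sym (Subset.x∈⁅y⁆⇒x≡y i₀ i∈)) i₀∈
    go zero {V} ∣F∣≤0 tree _ | yes (e , e∈) = case subst (_≤ 0) (Deletion.∣F∣≡ {V} tree e∈) ∣F∣≤0 of λ ()
    go (suc k) {V} {F} ∣F∣≤ tree _ | yes (e , e∈) = begin
      suc ∣ F ∣                                   ≡⟨ cong suc ∣F∣≡ ⟩
      suc (suc (∣ sideEdges a ∣ + ∣ sideEdges b ∣)) ≡⟨ cong suc (sym (ℕ.+-suc _ _)) ⟩
      suc ∣ sideEdges a ∣ + (suc ∣ sideEdges b ∣)   ≡⟨ cong₂ _+_ (go k ≤a (side-tree a∈) (side-nonempty a∈)) (go k ≤b (side-tree b∈) (side-nonempty b∈)) ⟩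
      ∣ side a ∣ + ∣ side b ∣                       ≡⟨ sym (∣∣-partition vertices-split sides-disjoint) ⟩
      ∣ V ∣                                         ∎
      where
      open ≡.≡-Reasoning
      open Deletion {V} tree e∈
      a = end₁ e
      b = end₂ e
      a∈ = proj₁ (proj₁ (proj₁ tree) e e∈)
      b∈ = proj₂ (proj₁ (proj₁ tree) e e∈)
      side-nonempty : ∀ {c} → c ∈ᵥ V → Nonempty (side c)
      side-nonempty c∈ with ∈ᵥ⇒vertex {V = V} c∈
      ... | i , refl = i , ∈-side⁺ (Equivalence.to ∈ᵥ⇔∈ₛ c∈) here
      ∣E∣≤k : ∣ sideEdges a ∣ + ∣ sideEdges b ∣ ≤ k
      ∣E∣≤k = ℕ.≤-pred (subst (_≤ suc k) ∣F∣≡ ∣F∣≤)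
      ≤a = ℕ.≤-trans (ℕ.m≤m+n _ _) ∣E∣≤k
      ≤b = ℕ.≤-trans (ℕ.m≤n+m _ _) ∣E∣≤k

-- The sign-reversing involution on subgraph triples

Enumerates : ∀ {A : Set} → List A → (A → Set) → Set
Enumerates L P = ∀ x → (x ∈ L → P x) × (P x → x ∈ L)

module SubgraphTripleSums (ord : List Edge) {N : ℕ} (graph : IsGraph N ord) where

  open Graph ord graph

  T : Set
  T = Triple N M

  NoBad : Subset M → Set
  NoBad F = ∀ q → ¬ Bad F q

  noBad? : ∀ F → Dec (NoBad F)
  noBad? F with firstBad F in e
  ... | nothing = yes (first-nothing (bad? F) e)
  ... | just q = no (λ none → none q (proj₁ (first-just (bad? F) e)))

  Fixed : List T → Set
  Fixed = All (NoBad ∘ edges)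

  fixed? : Decidable Fixed
  fixed? = All.all? (noBad? ∘ edges)

  toggleEdge : Fin M → T → T
  toggleEdge q t = record t { edges = toggle q (edges t) }

  ι : List T → List T
  ι [] = []
  ι (t ∷ S) with firstBad (edges t)
  ... | just q = toggleEdge q t ∷ S
  ... | nothing = t ∷ ι S

  ι-involutive : ∀ S → ι (ι S) ≡ S
  ι-involutive [] = refl
  ι-involutive (t ∷ S) with firstBad (edges t) in e
  ... | just q rewrite firstBad-toggle e = cong (_∷ S) (cong (λ E → record t { edges = E }) (toggle-toggle q (edges t)))
  ... | nothing rewrite e = cong (t ∷_) (ι-involutive S)

  ι-skeleton : ∀ S → SameSkeletons (ι S) S
  ι-skeleton [] = refl
  ι-skeleton (t ∷ S) with firstBad (edges t)
  ... | just q = refl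
  ... | nothing = cong (skeleton t ∷_) (ι-skeleton S)

  ι-unfixed : ∀ {S} → ¬ Fixed S → ¬ Fixed (ι S)
  ι-unfixed {[]} ¬fixed _ = ¬fixed []
  ι-unfixed {t ∷ S} ¬fixed fixed with firstBad (edges t) in e
  ... | just q = All.head fixed q (proj₁ (first-just (bad? _) (firstBad-toggle e)))
  ... | nothing = ι-unfixed (¬fixed ∘ (first-nothing (bad? _) e ∷_)) (All.tail fixed)

  ι-subgraphTriple : ∀ {S} → IsSubgraphTriple ord S → IsSubgraphTriple ord (ι S)
  ι-subgraphTriple {S} (components , partition) = go components , orderedPartition-skeletal (ι-skeleton S) partition
    where
    go : ∀ {S} → All (λ t → IsConnectedSubgraph ord (verts t) (edges t) × GoodLabels t) S →
         All (λ t → IsConnectedSubgraph ord (verts t) (edges t) × GoodLabels t) (ι S)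
    go [] = []
    go {t ∷ S} ((connected , labels) ∷ rest) with firstBad (edges t) in e
    ... | just q = (toggle-connected {verts t} (proj₁ (first-just (bad? _) e)) connected , labels) ∷ rest
    ... | nothing = (connected , labels) ∷ go rest

  fixed⇒forestTriple : ∀ {S} → Fixed S → IsSubgraphTriple ord S → IsForestTriple ord S
  fixed⇒forestTriple fixed (components , partition) = All.zipWith (λ {t} → tree {t}) (fixed , components) , partition
    where
    tree : ∀ {t : T} → NoBad (edges t) × IsConnectedSubgraph ord (verts t) (edges t) × GoodLabels t →
           IsNBCTree ord (verts t) (edges t) × GoodLabels t
    tree {t} (noBad , connected , labels) = no-bad⇒NBC {verts t} connected noBad , labels

  forestTriple⇒fixed : ∀ {S} → IsForestTriple ord S → Fixed S × IsSubgraphTriple ord S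
  forestTriple⇒fixed (trees , partition) = All.map (NBC⇒no-bad ∘ proj₂ ∘ proj₁) trees , All.map (λ {t} → connected {t}) trees , partition
    where
    connected : ∀ {t : T} → IsNBCTree ord (verts t) (edges t) × GoodLabels t →
                IsConnectedSubgraph ord (verts t) (edges t) × GoodLabels t
    connected (nbc , labels) = proj₁ (proj₁ nbc) , labels

  excessWith : T → ℕ → ℤ
  excessWith t e = (+ (length (comp t) ∸ 1)) ℤ.+ ((+ e) ℤ.- (+ ∣ verts t ∣) ℤ.+ + 1)

  -- The exponent of -1 in signS, triple by triple.
  excess : T → ℤ
  excess t = excessWith t ∣ edges t ∣

  -- + suc e reduces to + 1 ℤ.+ + e, the form in which these two identities are used.
  one-more-edge : ∀ a e v → a ℤ.+ ((+ 1 ℤ.+ e) ℤ.- v ℤ.+ + 1) ≡ (a ℤ.+ (e ℤ.- v ℤ.+ + 1)) ℤ.+ + 1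
  one-more-edge = solve-∀

  one-less-vertex : ∀ a e → a ℤ.+ (e ℤ.- (+ 1 ℤ.+ e) ℤ.+ + 1) ≡ a
  one-less-vertex = solve-∀

  excessWith-suc : ∀ t e → excessWith t (suc e) ≡ excessWith t e ℤ.+ + 1
  excessWith-suc t e = one-more-edge (+ (length (comp t) ∸ 1)) (+ e) (+ ∣ verts t ∣)

  excess-toggle : ∀ q t → OffByOne (excess t) (excess (toggleEdge q t))
  excess-toggle q t with q Subset.∈? edges t
  ... | yes q∈ = inj₂ (trans (cong (excessWith t) (sym (∣toggle∣-∈ q∈))) (excessWith-suc t _))
  ... | no q∉ = inj₁ (trans (cong (excessWith t) (∣toggle∣-∉ q∉)) (excessWith-suc t _))

  ι-excess : ∀ S → ¬ Fixed S → OffByOne (∑ excess S) (∑ excess (ι S))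
  ι-excess [] ¬fixed = contradiction [] ¬fixed
  ι-excess (t ∷ S) ¬fixed with firstBad (edges t) in e
  ... | just q = offByOne-+ʳ (∑ excess S) (excess-toggle q t)
  ... | nothing = offByOne-+ˡ (excess t) (ι-excess S (¬fixed ∘ (first-nothing (bad? _) e ∷_)))

  ι-sign : ∀ {S} → ¬ Fixed S → signS (ι S) ≡ - signS S
  ι-sign ¬fixed = negOnePow-offByOne (ι-excess _ ¬fixed)

  goodLabels⇒0<∣verts∣ : ∀ {t : T} → GoodLabels t → 1 ≤ ∣ verts t ∣
  goodLabels⇒0<∣verts∣ {t} ((_ , sum≡) , 1≤r , r≤head) with comp t
  ... | [] = contradiction (ℕ.≤-trans 1≤r r≤head) λ ()
  ... | c ∷ cs = ℕ.≤-trans (ℕ.≤-trans 1≤r r≤head) (subst (c ≤_) sum≡ (ℕ.m≤m+n c (sum cs)))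

  excess-tree : ∀ {t : T} → IsNBCTree ord (verts t) (edges t) → GoodLabels t → excess t ≡ + (length (comp t) ∸ 1)
  excess-tree {t} nbc labels =
    trans (cong (λ v → ℓ ℤ.+ ((+ ∣ edges t ∣) ℤ.- (+ v) ℤ.+ + 1)) (sym (tree-size {verts t} (proj₁ nbc) (0<∣p∣⇒nonempty (goodLabels⇒0<∣verts∣ {t} labels)))))
          (one-less-vertex ℓ (+ ∣ edges t ∣))
    where
    ℓ = + (length (comp t) ∸ 1)

  signS≡signF : ∀ {S} → IsForestTriple ord S → signS S ≡ signF S
  signS≡signF {S} (trees , _) = cong (negOnePow ∘ ℤ.∣_∣) (go trees)
    where
    go : ∀ {S} → All (λ t → IsNBCTree ord (verts t) (edges t) × GoodLabels t) S →
         ∑ excess S ≡ + sum (map (λ t → length (comp t) ∸ 1) S)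
    go [] = refl
    go {t ∷ _} ((nbc , labels) ∷ rest) = cong₂ ℤ._+_ (excess-tree {t} nbc labels) (go rest)

  summand : (List T → ℤ) → List ℕ → List T → ℤ
  summand sign λ′ S = if does (List.≡-dec ℕ._≟_ (type′ S) λ′) then sign S else + 0

  summand-cong : ∀ {sign sign′ : List T → ℤ} λ′ {S} → sign S ≡ sign′ S → summand sign λ′ S ≡ summand sign′ λ′ S
  summand-cong λ′ {S} e = cong (if does (List.≡-dec ℕ._≟_ (type′ S) λ′) then_else + 0) e

  ι-summand : ∀ λ′ {S} → ¬ Fixed S → summand signS λ′ (ι S) ≡ - summand signS λ′ S
  ι-summand λ′ {S} ¬fixed rewrite type′-skeletal (ι-skeleton S) with does (List.≡-dec ℕ._≟_ (type′ S) λ′)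
  ... | true = ι-sign ¬fixed
  ... | false = refl

  subgraph-sum≡forest-sum :
    ∀ (Cond : List T → Set) → Skeletal Cond →
    ∀ Ls → Unique Ls → Enumerates Ls (λ S → IsSubgraphTriple ord S × Cond S) →
    ∀ Lf → Unique Lf → Enumerates Lf (λ S → IsForestTriple ord S × Cond S) →
    ∀ λ′ → coeffE signS Ls λ′ ≡ coeffE signF Lf λ′
  subgraph-sum≡forest-sum Cond skeletal Ls uLs Ls-enum Lf uLf Lf-enum λ′ = begin
    ∑ (summand signS λ′) Ls                 ≡⟨ ∑-sign-reversing-involution (summand signS λ′) ι fixed? ι-involutive ι-unfixed (ι-summand λ′) uLs closed ⟩
    ∑ (summand signS λ′) (filter fixed? Ls) ≡⟨ ∑-cong (λ {S} S∈ → summand-cong {signS} {signF} λ′ {S} (signS≡signF (proj₁ (fixed-forest S∈)))) ⟩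
    ∑ (summand signF λ′) (filter fixed? Ls) ≡⟨ ∑-unique-⇔ (summand signF λ′) (Unique.filter⁺ fixed? uLs) uLf fixed≈forests ⟩
    ∑ (summand signF λ′) Lf                 ∎
    where
    open ≡.≡-Reasoning
    closed : ∀ {S} → S ∈ Ls → ι S ∈ Ls
    closed {S} S∈ = let (subgraph , cond) = proj₁ (Ls-enum S) S∈ in
      proj₂ (Ls-enum (ι S)) (ι-subgraphTriple subgraph , skeletal (ι-skeleton S) cond)
    fixed-forest : ∀ {S} → S ∈ filter fixed? Ls → IsForestTriple ord S × Cond S
    fixed-forest {S} S∈ = let (S∈Ls , fixed) = ∈-filter⁻ fixed? {xs = Ls} S∈ ; (subgraph , cond) = proj₁ (Ls-enum S) S∈Ls in
      fixed⇒forestTriple fixed subgraph , cond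
    fixed≈forests : ∀ {S} → S ∈ filter fixed? Ls ⇔ S ∈ Lf
    fixed≈forests {S} = mk⇔ (proj₂ (Lf-enum S) ∘ fixed-forest) λ S∈ →
      let (forest , cond) = proj₁ (Lf-enum S) S∈ ; (fixed , subgraph) = forestTriple⇒fixed forest in
      ∈-filter⁺ fixed? (proj₂ (Ls-enum S) (subgraph , cond)) fixed

-- The graph G + P_j

IsGraph-↭ : ∀ {N E E′} → E′ ↭ E → IsGraph N E → IsGraph N E′
IsGraph-↭ E′↭E (edges , unique) = All-resp-↭ (↭-sym E′↭E) edges , Unique-↭ (↭-sym E′↭E) unique

pathEdges-shape : ∀ v k → All (λ e → v ≤ proj₁ e × proj₂ e ≡ suc (proj₁ e) × suc (proj₂ e) ≤ v + k) (pathEdgesFrom v k)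
pathEdges-shape v zero = []
pathEdges-shape v (suc zero) = []
pathEdges-shape v (suc (suc k)) =
  (ℕ.≤-refl , refl , subst (suc (suc v) ≤_) (sym (trans (ℕ.+-suc v (suc k)) (cong suc (ℕ.+-suc v k)))) (s≤s (s≤s (ℕ.m≤m+n v k)))) ∷
  All.map (λ {e} (v<a , b≡ , b<) → ℕ.<⇒≤ v<a , b≡ , subst (suc (proj₂ e) ≤_) (sym (ℕ.+-suc v (suc k))) b<) (pathEdges-shape (suc v) (suc k))

pathEdges-unique : ∀ v k → Unique (pathEdgesFrom v k)
pathEdges-unique v zero = []
pathEdges-unique v (suc zero) = []
pathEdges-unique v (suc (suc k)) =
  All.map (λ (v<a , _) e≡ → ℕ.<-irrefl (cong proj₁ e≡) v<a) (pathEdges-shape (suc v) (suc k)) ∷ pathEdges-unique (suc v) (suc k)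

plusPath-isGraph : ∀ {n j E} → 1 ≤ n → 1 ≤ j → IsGraph n E → IsGraph (plusPathSize n j) (plusPathEdges n j E)
plusPath-isGraph {n} {suc j} {E} 1≤n _ (edges , unique) =
  All.++⁺ (All.map (λ (1≤a , a<b , b≤n) → 1≤a , a<b , ℕ.≤-trans b≤n n≤N) edges)
          (All.map (λ {e} (n≤a , b≡ , b<) → ℕ.≤-trans 1≤n n≤a , subst (proj₁ e <_) (sym b≡) ℕ.≤-refl
                                          , subst (proj₂ e ≤_) (sym N≡) (ℕ.≤-pred (subst (suc (proj₂ e) ≤_) (ℕ.+-suc n j) b<)))
                   (pathEdges-shape n (suc j))) ,
  Unique.++⁺ unique (pathEdges-unique n (suc j)) disjoint
  where
  N≡ : plusPathSize n (suc j) ≡ n + j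
  N≡ = cong (_∸ 1) (ℕ.+-suc n j)
  n≤N : n ≤ plusPathSize n (suc j)
  n≤N = subst (n ≤_) (sym N≡) (ℕ.m≤m+n n j)
  disjoint : ∀ {e} → ¬ (e ∈ E × e ∈ pathEdgesFrom n (suc j))
  disjoint (e∈E , e∈P) with All.lookup edges e∈E | All.lookup (pathEdges-shape n (suc j)) e∈P
  ... | (_ , a<b , b≤n) | (n≤a , _) = ℕ.<-irrefl refl (ℕ.<-≤-trans a<b (ℕ.≤-trans b≤n n≤a))

superscriptCond-skeletal : ∀ {N m} n j i → Skeletal {N} {m} (SuperscriptCond n j i)
superscriptCond-skeletal n j i same (starts , ends) =
  all-skeletal (λ s → 1 ∈ᵥ proj₁ s → headOr0 (proj₁ (proj₂ s)) ≡ i × proj₂ (proj₂ s) ≡ 1) same starts ,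
  all-skeletal (λ s → n ∈ᵥ proj₁ s → (∀ v → n ≤ v → v ≤ n + j ∸ 1 → v ∈ᵥ proj₁ s) × j ≤ lastOr0 (proj₁ (proj₂ s))) same ends

proposition5p13 : (n j i : ℕ) → 1 ≤ n → 1 ≤ j → 1 ≤ i →
    (E : List Edge) → IsGraph n E →
    (ord : List Edge) → ord ↭ plusPathEdges n j E →
    (Ls : List (List (Triple (plusPathSize n j) (m ord)))) → Unique Ls →
    (∀ S → (S ∈ Ls → IsSubgraphTriple ord S × SuperscriptCond n j i S)
         × (IsSubgraphTriple ord S × SuperscriptCond n j i S → S ∈ Ls)) →
    (Lf : List (List (Triple (plusPathSize n j) (m ord)))) → Unique Lf →
    (∀ F → (F ∈ Lf → IsForestTriple ord F × SuperscriptCond n j i F)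
         × (IsForestTriple ord F × SuperscriptCond n j i F → F ∈ Lf)) →
    (λ′ : List ℕ) → coeffE signS Ls λ′ ≡ coeffE signF Lf λ′
proposition5p13 n j i 1≤n 1≤j _ E isGraph ord ord↭ =
  SubgraphTripleSums.subgraph-sum≡forest-sum ord (IsGraph-↭ ord↭ (plusPath-isGraph 1≤n 1≤j isGraph))
    (SuperscriptCond n j i) (superscriptCond-skeletal n j i)
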